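{- Let $C(x)$ be the Thue–Morse continued fraction. Then $$C(x)\equiv 1-\sum_{i,j=0}^{\infty}x^{2^i+2^j-1}+2\sum_{k=0}^{\infty}x^{2^{2k}}\pmod 4,$$ where the first sum runs over all ordered pairs $(i,j)$ of nonnegative integers.
   Context: Thue–Morse sequence: $t_0=1$, $t_{2n}=t_n$ ($n\ge1$), $t_{2n+1}=-t_n$. $C(x)\in\mathbb{Z}[[x]]$ is the Stieltjes continued fraction $t_0/(1+t_1x/(1+t_2x/(1+\cdots)))$, i.e. the $x$-adic limit of its finite truncations $t_0/(1+t_1x/(1+\cdots/(1+t_nx)))$. Congruence modulo 4 is coefficientwise. -}

module Defs where

open import Data.Nat as ℕ using (ℕ; zero; suc; ⌊_/2⌋; _^_; _≡ᵇ_; _≤_)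
open import Data.Integer as ℤ using (ℤ; +_; -_; _-_)
open import Data.Integer.Divisibility using (_∣_)
open import Data.Bool using (Bool; true; false; if_then_else_)
open import Data.List using (List; []; _∷_)

-- Thue–Morse sequence  t₀ = 1, t_{2n} = t_n, t_{2n+1} = -t_n.
-- Defined by recursion with fuel (fuel f ≥ n suffices since n/2 < n).

even? : ℕ → Bool
even? zero = true
even? (suc zero) = false
even? (suc (suc n)) = even? n

tmFuel : ℕ → ℕ → ℤ
tmFuel zero _ = + 1
tmFuel (suc f) zero = + 1
tmFuel (suc f) (suc n) =
  if even? (suc n) then tmFuel f ⌊ suc n /2⌋ else - tmFuel f ⌊ suc n /2⌋

tm : ℕ → ℤ
tm n = tmFuel n n

Series : Set
Series = ℕ → ℤ

const : ℤ → Series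
const a zero = a
const a (suc _) = + 0

convAux : Series → Series → ℕ → ℕ → ℤ
convAux f g m zero = f 0 ℤ.* g m
convAux f g m (suc k) = f (suc k) ℤ.* g (m ℕ.∸ suc k) ℤ.+ convAux f g m k

_*ₛ_ : Series → Series → Series
(f *ₛ g) m = convAux f g m m

onePlusXTimes : ℤ → Series → Series
onePlusXTimes c g zero = + 1
onePlusXTimes c g (suc m) = c ℤ.* g m

-- Multiplicative inverse of a series with constant term 1:
-- g₀ = 1,  g_m = - Σ_{j=0}^{m-1} f_{m-j} g_j.
-- invRev f m = [g_m, g_{m-1}, …, g_0].
dotShift : Series → ℕ → List ℤ → ℤ
dotShift f k [] = + 0
dotShift f k (a ∷ as) = f (suc k) ℤ.* a ℤ.+ dotShift f (suc k) as

invRev : Series → ℕ → List ℤ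
invRev f zero = + 1 ∷ []
invRev f (suc m) = let r = invRev f m in (- dotShift f 0 r) ∷ r

head0 : List ℤ → ℤ
head0 [] = + 0
head0 (a ∷ _) = a

inv : Series → Series
inv f m = head0 (invRev f m)

-- Finite truncations of the Thue–Morse S-fraction.
-- H r j = 1 + t_j x / (1 + t_{j+1} x / ( ⋯ / (1 + t_{j+r} x)))
H : ℕ → ℕ → Series
H zero j = onePlusXTimes (tm j) (const (+ 1))
H (suc r) j = onePlusXTimes (tm j) (inv (H r (suc j)))

-- trunc n = t₀ / (1 + t₁x / (1 + ⋯ / (1 + t_n x)))
trunc : ℕ → Series
trunc zero = const (tm 0)
trunc (suc d) = const (tm 0) *ₛ inv (H d 1)

-- Right-hand side  1 - Σ_{i,j≥0} x^{2^i+2^j-1} + 2 Σ_{k≥0} x^{4^k}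
-- coefficientwise.  For the coefficient of x^m only i, j, k ≤ m
-- can contribute (2^i ≥ i+1, 4^k ≥ k+1), so the sums are finite.

ind : Bool → ℤ
ind true = + 1
ind false = + 0

sumUpTo : ℕ → (ℕ → ℤ) → ℤ
sumUpTo zero f = f 0
sumUpTo (suc n) f = f (suc n) ℤ.+ sumUpTo n f

pairCount : ℕ → ℤ
pairCount m = sumUpTo m λ i → sumUpTo m λ j → ind ((2 ^ i ℕ.+ 2 ^ j) ≡ᵇ suc m)

fourPowCount : ℕ → ℤ
fourPowCount m = sumUpTo m λ k → ind (2 ^ (2 ℕ.* k) ≡ᵇ m)

rhs : Series
rhs m = const (+ 1) m - pairCount m ℤ.+ + 2 ℤ.* fourPowCount m

_≡₄_ : ℤ → ℤ → Set
a ≡₄ b = + 4 ∣ (a - b)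

-- Write t_j = 1 - 2 e_j with e_j = tmBit j ∈ {0, 1}, s = Σ x^(2^i), R = 1 - Σ x^(2^i + 2^j - 1) and u = x R².
-- Then x R = x - s², and as s = x + s(x²) while squaring is the Frobenius map modulo 2, R (1 + x R) ≡ 1
-- modulo 4: R is the continued fraction with all t_j = 1. Inducting along the continued fraction, its tail
-- starting at t_j is R + 2 R Σ_k e_{j+k-1} u^k modulo 4, so C ≡ R + 2 w with w = R Σ_k e_k u^k.
-- Modulo 2 the recurrences e_{2k} = e_k, e_{2k+1} = 1 - e_k give w ≡ w² + s, an equation that P = Σ x^(4^k)
-- also satisfies; the difference d of two solutions with d₀ = 0 satisfies d ≡ d² ≡ d(x²), hence vanishes.
-- So 2 w ≡ 2 P modulo 4.
module Submission where

open import Defs renaming (_*ₛ_ to infixl 7 _*ₛ_)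
open import Data.Nat as ℕ using (ℕ; zero; suc; _≤_; _<_; z≤n; s≤s; _∸_; _^_; _≡ᵇ_; ⌊_/2⌋)
import Data.Nat.Properties as ℕ
open import Data.Nat.Induction using (<-rec)
open import Data.Integer as ℤ using (ℤ; +_; -[1+_]; 0ℤ; 1ℤ; _+_; _*_; -_; _-_)
import Data.Integer.Properties as ℤ
open import Data.Integer.DivMod using (_/_; _%_; a≡a%n+[a/n]*n; n%d<d)
open import Data.Integer.Tactic.RingSolver using (solve-∀)
open import Data.Integer.Divisibility.Signed using (_∣_; divides; ∣m∣n⇒∣m+n; ∣m⇒∣-m; ∣m⇒∣m*n; ∣n⇒∣m*n; ∣-trans; ∣⇒∣ᵤ)
open import Data.Bool using (true; false; T; if_then_else_)
open import Data.Unit using (tt)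
open import Data.Empty using (⊥-elim)
open import Data.Maybe using (Maybe; just; nothing)
open import Data.Product using (∃; Σ; _,_)
open import Data.Sum using (_⊎_; inj₁; inj₂)
open import Relation.Nullary using (yes; no)
open import Relation.Binary.Bundles using (Setoid)
open import Relation.Binary.PropositionalEquality
open import Algebra.Solver.Ring.AlmostCommutativeRing
import Relation.Binary.Reasoning.Setoid as SetoidReasoning

-- A record rather than a type synonym, so that a, b and q can be inferred.
infix 4 _≡_[mod_]
record _≡_[mod_] (a b q : ℤ) : Set where
  constructor ≡-mod
  field ∣-diff : q ∣ a - b
open _≡_[mod_]

module _ {q : ℤ} where

  mod-reflexive : ∀ {a b} → a ≡ b → a ≡ b [mod q ]
  mod-reflexive {a} refl = ≡-mod (divides 0ℤ (trans (ℤ.+-inverseʳ a) (sym (ℤ.*-zeroˡ q))))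

  mod-refl : ∀ {a} → a ≡ a [mod q ]
  mod-refl = mod-reflexive refl

  mod-sym : ∀ {a b} → a ≡ b [mod q ] → b ≡ a [mod q ]
  mod-sym {a} {b} (≡-mod p) = ≡-mod (subst (q ∣_) (neg-diff a b) (∣m⇒∣-m p))
    where
    neg-diff : ∀ a b → - (a - b) ≡ b - a
    neg-diff = solve-∀

  mod-trans : ∀ {a b c} → a ≡ b [mod q ] → b ≡ c [mod q ] → a ≡ c [mod q ]
  mod-trans {a} {b} {c} (≡-mod p) (≡-mod r) = ≡-mod (subst (q ∣_) (telescope a b c) (∣m∣n⇒∣m+n p r))
    where
    telescope : ∀ a b c → (a - b) + (b - c) ≡ a - c
    telescope = solve-∀

  mod-+ : ∀ {a b c d} → a ≡ b [mod q ] → c ≡ d [mod q ] → a + c ≡ b + d [mod q ]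
  mod-+ {a} {b} {c} {d} (≡-mod p) (≡-mod r) = ≡-mod (subst (q ∣_) (diff-+ a b c d) (∣m∣n⇒∣m+n p r))
    where
    diff-+ : ∀ a b c d → (a - b) + (c - d) ≡ (a + c) - (b + d)
    diff-+ = solve-∀

  mod-* : ∀ {a b c d} → a ≡ b [mod q ] → c ≡ d [mod q ] → a * c ≡ b * d [mod q ]
  mod-* {a} {b} {c} {d} (≡-mod p) (≡-mod r) =
    ≡-mod (subst (q ∣_) (diff-* a b c d) (∣m∣n⇒∣m+n (∣m⇒∣m*n c p) (∣n⇒∣m*n b r)))
    where
    diff-* : ∀ a b c d → (a - b) * c + b * (c - d) ≡ a * c - b * d
    diff-* = solve-∀

  mod-neg : ∀ {a b} → a ≡ b [mod q ] → - a ≡ - b [mod q ]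
  mod-neg {a} {b} (≡-mod p) = ≡-mod (subst (q ∣_) (diff-neg a b) (∣m⇒∣-m p))
    where
    diff-neg : ∀ a b → - (a - b) ≡ (- a) - (- b)
    diff-neg = solve-∀

  mod-∣ : ∀ {q′ a b} → q ∣ q′ → a ≡ b [mod q′ ] → a ≡ b [mod q ]
  mod-∣ d (≡-mod p) = ≡-mod (∣-trans d p)

  multiple≡0 : ∀ a → q * a ≡ 0ℤ [mod q ]
  multiple≡0 a = ≡-mod (divides a (trans (ℤ.+-identityʳ (q * a)) (ℤ.*-comm q a)))

mod-2*-lift : ∀ {a b} → a ≡ b [mod + 2 ] → + 2 * a ≡ + 2 * b [mod + 4 ]
mod-2*-lift {a} {b} (≡-mod (divides k eq)) = ≡-mod (divides k (begin
  + 2 * a - + 2 * b   ≡⟨ distrib a b ⟩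
  + 2 * (a - b)       ≡⟨ cong (+ 2 *_) eq ⟩
  + 2 * (k * + 2)     ≡⟨ regroup k ⟩
  k * + 4             ∎))
  where
  open ≡-Reasoning
  distrib : ∀ a b → + 2 * a - + 2 * b ≡ + 2 * (a - b)
  distrib = solve-∀
  regroup : ∀ k → + 2 * (k * + 2) ≡ k * + 4
  regroup = solve-∀

square≡self[mod2] : ∀ a → a * a ≡ a [mod + 2 ]
square≡self[mod2] a = subst (λ b → b * b ≡ b [mod + 2 ]) (sym (a≡a%n+[a/n]*n a (+ 2)))
                           (odd-or-even (a % + 2) (a / + 2) (n%d<d a (+ 2)))
  where
  odd-or-even : ∀ r k → r < 2 → (+ r + k * + 2) * (+ r + k * + 2) ≡ + r + k * + 2 [mod + 2 ]
  odd-or-even 0 k _ = ≡-mod (divides (k * (k * + 2 - 1ℤ)) (even-case k))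
    where
    even-case : ∀ k → (+ 0 + k * + 2) * (+ 0 + k * + 2) - (+ 0 + k * + 2) ≡ k * (k * + 2 - 1ℤ) * + 2
    even-case = solve-∀
  odd-or-even 1 k _ = ≡-mod (divides (k * (k * + 2 + 1ℤ)) (odd-case k))
    where
    odd-case : ∀ k → (+ 1 + k * + 2) * (+ 1 + k * + 2) - (+ 1 + k * + 2) ≡ k * (k * + 2 + 1ℤ) * + 2
    odd-case = solve-∀
  odd-or-even (suc (suc _)) _ (s≤s (s≤s ()))

-- Exact algebra of formal power series

infixl 6 _+ₛ_ _-ₛ_
infix 8 -ₛ_

_+ₛ_ : Series → Series → Series
(f +ₛ g) k = f k + g k

-ₛ_ : Series → Series
(-ₛ f) k = - f k

_-ₛ_ : Series → Series → Series
f -ₛ g = f +ₛ (-ₛ g)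

0ₛ 1ₛ : Series
0ₛ = const 0ℤ
1ₛ = const 1ℤ

X : Series
X 1 = 1ℤ
X _ = 0ℤ

tail : Series → Series
tail f k = f (suc k)

infix 9 _⟨x²⟩
_⟨x²⟩ : Series → Series
(f ⟨x²⟩) zero = f zero
(f ⟨x²⟩) (suc zero) = 0ℤ
(f ⟨x²⟩) (suc (suc k)) = (tail f ⟨x²⟩) k

const-0 : ∀ k → 0ₛ k ≡ 0ℤ
const-0 zero = refl
const-0 (suc k) = refl

convAux-suc : ∀ f g m k → convAux f g (suc m) (suc k) ≡ f 0 * g (suc m) + convAux (tail f) g m k
convAux-suc f g m zero = ℤ.+-comm (f 1 * g m) (f 0 * g (suc m))
convAux-suc f g m (suc k) =
  trans (cong (λ z → f (suc (suc k)) * g (m ∸ suc k) + z) (convAux-suc f g m k))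
        (swap (f (suc (suc k)) * g (m ∸ suc k)) (f 0 * g (suc m)) (convAux (tail f) g m k))
  where
  swap : ∀ a b c → a + (b + c) ≡ b + (a + c)
  swap = solve-∀

*ₛ-suc : ∀ f g m → (f *ₛ g) (suc m) ≡ f 0 * g (suc m) + (tail f *ₛ g) m
*ₛ-suc f g m = convAux-suc f g m m

convAux-resp-≗ : ∀ {f f′ g g′} m k → f ≗ f′ → g ≗ g′ → convAux f g m k ≡ convAux f′ g′ m k
convAux-resp-≗ m zero p r = cong₂ _*_ (p 0) (r m)
convAux-resp-≗ m (suc k) p r = cong₂ _+_ (cong₂ _*_ (p (suc k)) (r (m ∸ suc k))) (convAux-resp-≗ m k p r)

*ₛ-resp-≗ : ∀ {f f′ g g′} → f ≗ f′ → g ≗ g′ → f *ₛ g ≗ f′ *ₛ g′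
*ₛ-resp-≗ p r m = convAux-resp-≗ m m p r

convAux-distribʳ-+ₛ : ∀ f f′ g m k → convAux (f +ₛ f′) g m k ≡ convAux f g m k + convAux f′ g m k
convAux-distribʳ-+ₛ f f′ g m zero = ℤ.*-distribʳ-+ (g m) (f 0) (f′ 0)
convAux-distribʳ-+ₛ f f′ g m (suc k) =
  trans (cong₂ _+_ (ℤ.*-distribʳ-+ (g (m ∸ suc k)) (f (suc k)) (f′ (suc k))) (convAux-distribʳ-+ₛ f f′ g m k))
        (interchange (f (suc k) * g (m ∸ suc k)) (f′ (suc k) * g (m ∸ suc k)) (convAux f g m k) (convAux f′ g m k))
  where
  interchange : ∀ a b c d → (a + b) + (c + d) ≡ (a + c) + (b + d)
  interchange = solve-∀

*ₛ-distribʳ-+ₛ : ∀ h f g → (f +ₛ g) *ₛ h ≗ f *ₛ h +ₛ g *ₛ h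
*ₛ-distribʳ-+ₛ h f g m = convAux-distribʳ-+ₛ f g h m m

convAux-scaleˡ : ∀ c f g m k → convAux (λ i → c * f i) g m k ≡ c * convAux f g m k
convAux-scaleˡ c f g m zero = ℤ.*-assoc c (f 0) (g m)
convAux-scaleˡ c f g m (suc k) =
  trans (cong₂ _+_ (ℤ.*-assoc c (f (suc k)) (g (m ∸ suc k))) (convAux-scaleˡ c f g m k))
        (sym (ℤ.*-distribˡ-+ c (f (suc k) * g (m ∸ suc k)) (convAux f g m k)))

*ₛ-scaleˡ : ∀ c f g m → ((λ i → c * f i) *ₛ g) m ≡ c * (f *ₛ g) m
*ₛ-scaleˡ c f g m = convAux-scaleˡ c f g m m

convAux-zeroˡ : ∀ f g m k → (∀ i → f i ≡ 0ℤ) → convAux f g m k ≡ 0ℤ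
convAux-zeroˡ f g m zero p = trans (cong (_* g m) (p 0)) (ℤ.*-zeroˡ (g m))
convAux-zeroˡ f g m (suc k) p =
  cong₂ _+_ (trans (cong (_* g (m ∸ suc k)) (p (suc k))) (ℤ.*-zeroˡ (g (m ∸ suc k)))) (convAux-zeroˡ f g m k p)

*ₛ-zeroˡ : ∀ f g → (∀ i → f i ≡ 0ℤ) → f *ₛ g ≗ 0ₛ
*ₛ-zeroˡ f g p m = trans (convAux-zeroˡ f g m m p) (sym (const-0 m))

const-*ₛ : ∀ c g m → (const c *ₛ g) m ≡ c * g m
const-*ₛ c g zero = refl
const-*ₛ c g (suc m) = begin
  (const c *ₛ g) (suc m)                ≡⟨ *ₛ-suc (const c) g m ⟩
  c * g (suc m) + (tail (const c) *ₛ g) m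
                                        ≡⟨ cong (λ z → c * g (suc m) + z) (*ₛ-zeroˡ (tail (const c)) g (λ _ → refl) m) ⟩
  c * g (suc m) + 0ₛ m                  ≡⟨ cong (λ z → c * g (suc m) + z) (const-0 m) ⟩
  c * g (suc m) + 0ℤ                    ≡⟨ ℤ.+-identityʳ _ ⟩
  c * g (suc m)                         ∎
  where open ≡-Reasoning

*ₛ-identityˡ : ∀ g → 1ₛ *ₛ g ≗ g
*ₛ-identityˡ g m = trans (const-*ₛ 1ℤ g m) (ℤ.*-identityˡ (g m))

*ₛ-comm : ∀ f g → f *ₛ g ≗ g *ₛ f
*ₛ-comm f g zero = ℤ.*-comm (f 0) (g 0)
*ₛ-comm f g (suc zero) = trans (*ₛ-suc f g 0) (trans (swap (f 0) (g 1) (f 1) (g 0)) (sym (*ₛ-suc g f 0)))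
  where
  swap : ∀ a b c d → a * b + c * d ≡ d * c + b * a
  swap = solve-∀
*ₛ-comm f g (suc (suc m)) = begin
  (f *ₛ g) (suc (suc m))                                     ≡⟨ *ₛ-suc f g (suc m) ⟩
  f 0 * g (suc (suc m)) + (tail f *ₛ g) (suc m)              ≡⟨ cong (λ z → f 0 * g (suc (suc m)) + z) (*ₛ-comm (tail f) g (suc m)) ⟩
  f 0 * g (suc (suc m)) + (g *ₛ tail f) (suc m)              ≡⟨ cong (λ z → f 0 * g (suc (suc m)) + z) (*ₛ-suc g (tail f) m) ⟩
  f 0 * g (suc (suc m)) + (g 0 * f (suc (suc m)) + (tail g *ₛ tail f) m)
       ≡⟨ cong (λ z → f 0 * g (suc (suc m)) + (g 0 * f (suc (suc m)) + z)) (*ₛ-comm (tail g) (tail f) m) ⟩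
  f 0 * g (suc (suc m)) + (g 0 * f (suc (suc m)) + (tail f *ₛ tail g) m)
       ≡⟨ swap (f 0 * g (suc (suc m))) (g 0 * f (suc (suc m))) ((tail f *ₛ tail g) m) ⟩
  g 0 * f (suc (suc m)) + (f 0 * g (suc (suc m)) + (tail f *ₛ tail g) m)
       ≡⟨ cong (λ z → g 0 * f (suc (suc m)) + z) (sym (*ₛ-suc f (tail g) m)) ⟩
  g 0 * f (suc (suc m)) + (f *ₛ tail g) (suc m)              ≡⟨ cong (λ z → g 0 * f (suc (suc m)) + z) (*ₛ-comm f (tail g) (suc m)) ⟩
  g 0 * f (suc (suc m)) + (tail g *ₛ f) (suc m)              ≡⟨ sym (*ₛ-suc g f (suc m)) ⟩
  (g *ₛ f) (suc (suc m))                                     ∎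
  where
  open ≡-Reasoning
  swap : ∀ a b c → a + (b + c) ≡ b + (a + c)
  swap = solve-∀

*ₛ-zeroʳ : ∀ f → f *ₛ 0ₛ ≗ 0ₛ
*ₛ-zeroʳ f k = trans (*ₛ-comm f 0ₛ k) (*ₛ-zeroˡ 0ₛ f const-0 k)

*ₛ-assoc : ∀ f g h → (f *ₛ g) *ₛ h ≗ f *ₛ (g *ₛ h)
*ₛ-assoc f g h zero = ℤ.*-assoc (f 0) (g 0) (h 0)
*ₛ-assoc f g h (suc m) = begin
  ((f *ₛ g) *ₛ h) (suc m)
    ≡⟨ *ₛ-suc (f *ₛ g) h m ⟩
  f 0 * g 0 * h (suc m) + (tail (f *ₛ g) *ₛ h) m
    ≡⟨ cong (λ z → f 0 * g 0 * h (suc m) + z) (*ₛ-resp-≗ (*ₛ-suc f g) (λ _ → refl) m) ⟩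
  f 0 * g 0 * h (suc m) + (((λ i → f 0 * tail g i) +ₛ tail f *ₛ g) *ₛ h) m
    ≡⟨ cong (λ z → f 0 * g 0 * h (suc m) + z) (*ₛ-distribʳ-+ₛ h (λ i → f 0 * tail g i) (tail f *ₛ g) m) ⟩
  f 0 * g 0 * h (suc m) + (((λ i → f 0 * tail g i) *ₛ h) m + ((tail f *ₛ g) *ₛ h) m)
    ≡⟨ cong (λ z → f 0 * g 0 * h (suc m) + z) (cong₂ _+_ (*ₛ-scaleˡ (f 0) (tail g) h m) (*ₛ-assoc (tail f) g h m)) ⟩
  f 0 * g 0 * h (suc m) + (f 0 * (tail g *ₛ h) m + (tail f *ₛ (g *ₛ h)) m)
    ≡⟨ regroup (f 0) (g 0) (h (suc m)) ((tail g *ₛ h) m) ((tail f *ₛ (g *ₛ h)) m) ⟩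
  f 0 * (g 0 * h (suc m) + (tail g *ₛ h) m) + (tail f *ₛ (g *ₛ h)) m
    ≡⟨ cong (λ z → f 0 * z + (tail f *ₛ (g *ₛ h)) m) (sym (*ₛ-suc g h m)) ⟩
  f 0 * (g *ₛ h) (suc m) + (tail f *ₛ (g *ₛ h)) m
    ≡⟨ sym (*ₛ-suc f (g *ₛ h) m) ⟩
  (f *ₛ (g *ₛ h)) (suc m) ∎
  where
  open ≡-Reasoning
  regroup : ∀ a b c d e → a * b * c + (a * d + e) ≡ a * (b * c + d) + e
  regroup = solve-∀

-ₛ-*ₛ : ∀ f g → (-ₛ f) *ₛ g ≗ -ₛ (f *ₛ g)
-ₛ-*ₛ f g m = trans (*ₛ-resp-≗ {g = g} (λ i → sym (ℤ.-1*i≡-i (f i))) (λ _ → refl) m)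
                    (trans (*ₛ-scaleˡ (- 1ℤ) f g m) (ℤ.-1*i≡-i _))

const-+ₛ : ∀ a b → const (a + b) ≗ const a +ₛ const b
const-+ₛ a b zero = refl
const-+ₛ a b (suc k) = refl

const-*ₛ-const : ∀ a b → const (a * b) ≗ const a *ₛ const b
const-*ₛ-const a b zero = refl
const-*ₛ-const a b (suc k) = sym (trans (const-*ₛ a (const b) (suc k)) (ℤ.*-zeroʳ a))

const-neg : ∀ a → const (- a) ≗ -ₛ const a
const-neg a zero = refl
const-neg a (suc k) = refl

infix 4 _≈[_,_]_
_≈[_,_]_ : Series → ℤ → ℕ → Series → Set
f ≈[ q , n ] g = ∀ k → k ≤ n → f k ≡ g k [mod q ]

module _ {q : ℤ} {n : ℕ} where

  ≗⇒≈ : ∀ {f g} → f ≗ g → f ≈[ q , n ] g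
  ≗⇒≈ p k _ = mod-reflexive (p k)

  ≈-refl : ∀ {f} → f ≈[ q , n ] f
  ≈-refl _ _ = mod-refl

  ≈-sym : ∀ {f g} → f ≈[ q , n ] g → g ≈[ q , n ] f
  ≈-sym p k k≤n = mod-sym (p k k≤n)

  ≈-trans : ∀ {f g h} → f ≈[ q , n ] g → g ≈[ q , n ] h → f ≈[ q , n ] h
  ≈-trans p r k k≤n = mod-trans (p k k≤n) (r k k≤n)

  ≈-∣ : ∀ {q′ f g} → q ∣ q′ → f ≈[ q′ , n ] g → f ≈[ q , n ] g
  ≈-∣ d p k k≤n = mod-∣ d (p k k≤n)

  +ₛ-cong : ∀ {f f′ g g′} → f ≈[ q , n ] f′ → g ≈[ q , n ] g′ → f +ₛ g ≈[ q , n ] f′ +ₛ g′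
  +ₛ-cong p r k k≤n = mod-+ (p k k≤n) (r k k≤n)

  -ₛ-cong : ∀ {f g} → f ≈[ q , n ] g → -ₛ f ≈[ q , n ] -ₛ g
  -ₛ-cong p k k≤n = mod-neg (p k k≤n)

  const-cong : ∀ {a b} → a ≡ b [mod q ] → const a ≈[ q , n ] const b
  const-cong p zero _ = p
  const-cong p (suc k) _ = mod-refl

  *ₛ-cong : ∀ {f f′ g g′} → f ≈[ q , n ] f′ → g ≈[ q , n ] g′ → f *ₛ g ≈[ q , n ] f′ *ₛ g′
  *ₛ-cong {f} {f′} {g} {g′} p r m m≤n = convAux-cong m ℕ.≤-refl
    where
    convAux-cong : ∀ k → k ≤ m → convAux f g m k ≡ convAux f′ g′ m k [mod q ]
    convAux-cong zero _ = mod-* (p 0 z≤n) (r m m≤n)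
    convAux-cong (suc k) k<m =
      mod-+ (mod-* (p (suc k) (ℕ.≤-trans k<m m≤n)) (r (m ∸ suc k) (ℕ.≤-trans (ℕ.m∸n≤m m (suc k)) m≤n)))
            (convAux-cong k (ℕ.<⇒≤ k<m))

≈-mono : ∀ {q n n′ f g} → n′ ≤ n → f ≈[ q , n ] g → f ≈[ q , n′ ] g
≈-mono n′≤n p k k≤n′ = p k (ℕ.≤-trans k≤n′ n′≤n)

module SeriesMod (q : ℤ) (n : ℕ) where

  infix 4 _≈_
  _≈_ : Series → Series → Set
  f ≈ g = f ≈[ q , n ] g

  seriesSetoid : Setoid _ _
  seriesSetoid = record { _≈_ = _≈_ ; isEquivalence = record { refl = ≈-refl ; sym = ≈-sym ; trans = ≈-trans } }

  private
    ring : AlmostCommutativeRing _ _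
    ring = record
      { Carrier = Series
      ; _≈_ = _≈_
      ; _+_ = _+ₛ_
      ; _*_ = _*ₛ_
      ; -_ = -ₛ_
      ; 0# = 0ₛ
      ; 1# = 1ₛ
      ; isAlmostCommutativeRing = record
        { isCommutativeSemiring = record
          { isSemiring = record
            { isSemiringWithoutAnnihilatingZero = record
              { +-isCommutativeMonoid = record
                { isMonoid = record
                  { isSemigroup = record
                    { isMagma = record { isEquivalence = Setoid.isEquivalence seriesSetoid ; ∙-cong = +ₛ-cong }
                    ; assoc = λ f g h → ≗⇒≈ (λ k → ℤ.+-assoc (f k) (g k) (h k)) }
                  ; identity = (λ f → ≗⇒≈ (λ k → trans (cong (_+ f k) (const-0 k)) (ℤ.+-identityˡ (f k))))
                             , (λ f → ≗⇒≈ (λ k → trans (cong (λ z → f k + z) (const-0 k)) (ℤ.+-identityʳ (f k)))) }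
                ; comm = λ f g → ≗⇒≈ (λ k → ℤ.+-comm (f k) (g k)) }
              ; *-cong = *ₛ-cong
              ; *-assoc = λ f g h → ≗⇒≈ (*ₛ-assoc f g h)
              ; *-identity = (λ f → ≗⇒≈ (*ₛ-identityˡ f))
                           , (λ f → ≗⇒≈ (λ k → trans (*ₛ-comm f 1ₛ k) (*ₛ-identityˡ f k)))
              ; distrib = (λ h f g → ≗⇒≈ (λ k → trans (*ₛ-comm h (f +ₛ g) k)
                                       (trans (*ₛ-distribʳ-+ₛ h f g k) (cong₂ _+_ (*ₛ-comm f h k) (*ₛ-comm g h k)))))
                        , (λ h f g → ≗⇒≈ (*ₛ-distribʳ-+ₛ h f g)) }
            ; zero = (λ f → ≗⇒≈ (*ₛ-zeroˡ 0ₛ f const-0)) , (λ f → ≗⇒≈ (*ₛ-zeroʳ f)) }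
          ; *-comm = λ f g → ≗⇒≈ (*ₛ-comm f g) }
        ; -‿cong = -ₛ-cong
        ; -‿*-distribˡ = λ f g → ≗⇒≈ (-ₛ-*ₛ f g)
        ; -‿+-comm = λ f g → ≗⇒≈ (λ k → sym (ℤ.neg-distrib-+ (f k) (g k)))
        }
      }

    const-homomorphism : ℤ.+-*-rawRing -Raw-AlmostCommutative⟶ ring
    const-homomorphism = record
      { ⟦_⟧ = const
      ; +-homo = λ a b → ≗⇒≈ (const-+ₛ a b)
      ; *-homo = λ a b → ≗⇒≈ (const-*ₛ-const a b)
      ; -‿homo = λ a → ≗⇒≈ (const-neg a)
      ; 0-homo = ≈-refl
      ; 1-homo = ≈-refl
      }

    const-≟ : ∀ a b → Maybe (const a ≈ const b)
    const-≟ a b with a ℤ.≟ b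
    ... | yes refl = just ≈-refl
    ... | no _ = nothing

  open import Algebra.Solver.Ring ℤ.+-*-rawRing ring const-homomorphism const-≟ public
    using (solve; _:=_; con; _:+_; _:-_; _:*_)
  open SetoidReasoning seriesSetoid public

X-*ₛ-suc : ∀ f m → (X *ₛ f) (suc m) ≡ f m
X-*ₛ-suc f m = trans (*ₛ-suc X f m) (trans (ℤ.+-identityˡ _) (trans (*ₛ-resp-≗ tail-X (λ _ → refl) m) (*ₛ-identityˡ f m)))
  where
  tail-X : tail X ≗ 1ₛ
  tail-X zero = refl
  tail-X (suc k) = refl

X-*ₛ-shift : ∀ {q n f g} → f ≈[ q , n ] g → X *ₛ f ≈[ q , suc n ] X *ₛ g
X-*ₛ-shift p zero _ = mod-refl
X-*ₛ-shift {f = f} {g} p (suc k) (s≤s k≤n) = subst₂ (_≡_[mod _ ]) (sym (X-*ₛ-suc f k)) (sym (X-*ₛ-suc g k)) (p k k≤n)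

X-*ₛ-cancel : ∀ {q n f g} → X *ₛ f ≈[ q , suc n ] X *ₛ g → f ≈[ q , n ] g
X-*ₛ-cancel {f = f} {g} p k k≤n = subst₂ (_≡_[mod _ ]) (X-*ₛ-suc f k) (X-*ₛ-suc g k) (p (suc k) (s≤s k≤n))

X-*ₛ-≈0 : ∀ {q f g} → X *ₛ f ≈[ q , 0 ] X *ₛ g
X-*ₛ-≈0 zero _ = mod-refl

head+X*tail : ∀ f → f ≗ const (f 0) +ₛ X *ₛ tail f
head+X*tail f zero = sym (ℤ.+-identityʳ (f 0))
head+X*tail f (suc m) = sym (trans (ℤ.+-identityˡ _) (X-*ₛ-suc (tail f) m))

⟨x²⟩-head+X²*tail : ∀ f → f ⟨x²⟩ ≗ const (f 0) +ₛ X *ₛ (X *ₛ tail f ⟨x²⟩)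
⟨x²⟩-head+X²*tail f zero = sym (ℤ.+-identityʳ (f 0))
⟨x²⟩-head+X²*tail f (suc zero) = sym (trans (ℤ.+-identityˡ _) (X-*ₛ-suc (X *ₛ tail f ⟨x²⟩) 0))
⟨x²⟩-head+X²*tail f (suc (suc k)) =
  sym (trans (ℤ.+-identityˡ _) (trans (X-*ₛ-suc (X *ₛ tail f ⟨x²⟩) (suc k)) (X-*ₛ-suc (tail f ⟨x²⟩) k)))

onePlusXTimes-≗ : ∀ c g → onePlusXTimes c g ≗ 1ₛ +ₛ const c *ₛ (X *ₛ g)
onePlusXTimes-≗ c g zero = sym (cong (λ z → 1ℤ + z) (ℤ.*-zeroʳ c))
onePlusXTimes-≗ c g (suc m) = sym (trans (ℤ.+-identityˡ _) (trans (const-*ₛ c (X *ₛ g) (suc m)) (cong (c *_) (X-*ₛ-suc g m))))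

inv-inverseˡ : ∀ h → h 0 ≡ 1ℤ → inv h *ₛ h ≗ 1ₛ
inv-inverseˡ h h₀≡1 zero = cong (1ℤ *_) h₀≡1
inv-inverseˡ h h₀≡1 (suc m) =
  trans (cong₂ _+_ (cong₂ _*_ (cong -_ (dotShift-invRev 0 m)) (trans (cong h (ℕ.n∸n≡0 m)) h₀≡1))
                   (convAux-tail (inv h) h m m ℕ.≤-refl))
        (cancel (convAux (inv h) (tail h) m m))
  where
  cancel : ∀ a → - a * 1ℤ + a ≡ 0ℤ
  cancel = solve-∀

  convAux-tail : ∀ g f M K → K ≤ M → convAux g f (suc M) K ≡ convAux g (tail f) M K
  convAux-tail g f M zero _ = refl
  convAux-tail g f M (suc K) K<M =
    cong₂ _+_ (cong (λ z → g (suc K) * f z) (ℕ.+-∸-assoc 1 K<M)) (convAux-tail g f M K (ℕ.<⇒≤ K<M))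

  dotShift-invRev : ∀ k m → dotShift h k (invRev h m) ≡ convAux (inv h) (λ j → h (suc k ℕ.+ j)) m m
  dotShift-invRev k zero =
    trans (ℤ.+-identityʳ _) (trans (ℤ.*-comm (h (suc k)) 1ℤ) (cong (λ i → 1ℤ * h (suc i)) (sym (ℕ.+-identityʳ k))))
  dotShift-invRev k (suc m) = begin
    h (suc k) * inv h (suc m) + dotShift h (suc k) (invRev h m)
      ≡⟨ cong₂ _+_ (trans (ℤ.*-comm (h (suc k)) (inv h (suc m))) (cong (λ i → inv h (suc m) * h (suc i)) (sym (ℕ.+-identityʳ k))))
                   (dotShift-invRev (suc k) m) ⟩
    inv h (suc m) * h (suc k ℕ.+ 0) + convAux (inv h) (λ j → h (suc (suc k) ℕ.+ j)) m m
      ≡⟨ cong₂ _+_ (cong (λ i → inv h (suc m) * h (suc k ℕ.+ i)) (sym (ℕ.n∸n≡0 m)))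
                   (sym (trans (convAux-tail (inv h) (λ j → h (suc k ℕ.+ j)) m m ℕ.≤-refl)
                               (convAux-resp-≗ m m (λ _ → refl) (λ j → cong (λ i → h (suc i)) (ℕ.+-suc k j))))) ⟩
    convAux (inv h) (λ j → h (suc k ℕ.+ j)) (suc m) (suc m) ∎
    where open ≡-Reasoning

module _ {q : ℤ} {n : ℕ} where
  open SeriesMod q n

  inv-unique : ∀ {g h} → h 0 ≡ 1ℤ → g *ₛ h ≈ 1ₛ → g ≈ inv h
  inv-unique {g} {h} h₀≡1 gh≈1 = begin
    g                    ≈⟨ solve 1 (λ g → g := g :* con 1ℤ) ≈-refl g ⟩
    g *ₛ 1ₛ              ≈⟨ *ₛ-cong {f = g} ≈-refl (≗⇒≈ (inv-inverseˡ h h₀≡1)) ⟨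
    g *ₛ (inv h *ₛ h)    ≈⟨ solve 3 (λ a b c → a :* (b :* c) := (a :* c) :* b) ≈-refl g (inv h) h ⟩
    (g *ₛ h) *ₛ inv h    ≈⟨ *ₛ-cong gh≈1 (≈-refl {f = inv h}) ⟩
    1ₛ *ₛ inv h          ≈⟨ ≗⇒≈ (*ₛ-identityˡ (inv h)) ⟩
    inv h                ∎

double : ℕ → ℕ
double zero = zero
double (suc k) = suc (suc (double k))

double≡2* : ∀ k → double k ≡ 2 ℕ.* k
double≡2* zero = refl
double≡2* (suc k) = cong suc (trans (cong suc (double≡2* k)) (sym (ℕ.+-suc k (k ℕ.+ 0))))

double-injective : ∀ {a b} → double a ≡ double b → a ≡ b
double-injective {zero} {zero} _ = refl
double-injective {suc a} {suc b} eq = cong suc (double-injective (ℕ.suc-injective (ℕ.suc-injective eq)))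

double≢odd : ∀ a b → double a ≢ suc (double b)
double≢odd (suc a) (suc b) eq = double≢odd a b (ℕ.suc-injective (ℕ.suc-injective eq))

n≤double : ∀ k → k ≤ double k
n≤double zero = z≤n
n≤double (suc k) = s≤s (ℕ.m≤n⇒m≤1+n (n≤double k))

n<double : ∀ k → suc k < double (suc k)
n<double k = s≤s (s≤s (n≤double k))

data Parity : ℕ → Set where
  even : ∀ k → Parity (double k)
  odd : ∀ k → Parity (suc (double k))

parity : ∀ m → Parity m
parity zero = even 0
parity (suc m) with parity m
... | even k = odd k
... | odd k = even (suc k)

⟨x²⟩-even : ∀ f k → (f ⟨x²⟩) (double k) ≡ f k
⟨x²⟩-even f zero = refl
⟨x²⟩-even f (suc k) = ⟨x²⟩-even (tail f) k

⟨x²⟩-odd : ∀ f k → (f ⟨x²⟩) (suc (double k)) ≡ 0ℤ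
⟨x²⟩-odd f zero = refl
⟨x²⟩-odd f (suc k) = ⟨x²⟩-odd (tail f) k

const*ₛ≈0 : ∀ {q n} f → const q *ₛ f ≈[ q , n ] 0ₛ
const*ₛ≈0 {q} f k _ = subst₂ (_≡_[mod q ]) (sym (const-*ₛ q f k)) (sym (const-0 k)) (multiple≡0 (f k))

2*ₛ-lift : ∀ {n f g} → f ≈[ + 2 , n ] g → const (+ 2) *ₛ f ≈[ + 4 , n ] const (+ 2) *ₛ g
2*ₛ-lift {f = f} {g} p k k≤n =
  subst₂ (_≡_[mod + 4 ]) (sym (const-*ₛ (+ 2) f k)) (sym (const-*ₛ (+ 2) g k)) (mod-2*-lift (p k k≤n))

-- The quotient series h is exact up to degree n, so the congruence holds for every modulus.
halve : ∀ {n f g} → f ≈[ + 2 , n ] g → Σ Series λ h → ∀ {q} → f ≈[ q , n ] g +ₛ const (+ 2) *ₛ h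
halve {n} {f} {g} p = h , λ k k≤n → mod-reflexive (trans (f≡g+2h k k≤n) (cong (λ z → g k + z) (sym (const-*ₛ (+ 2) h k))))
  where
  h : Series
  h k with k ℕ.≤? n
  ... | yes k≤n = _∣_.quotient (∣-diff (p k k≤n))
  ... | no _ = 0ℤ
  f≡g+2h : ∀ k → k ≤ n → f k ≡ g k + + 2 * h k
  f≡g+2h k k≤n with k ℕ.≤? n
  ... | yes k≤n′ = solve-diff (f k) (g k) _ (_∣_.equality (∣-diff (p k k≤n′)))
    where
    solve-diff : ∀ a b c → a - b ≡ c * + 2 → a ≡ b + + 2 * c
    solve-diff a b c eq = trans (shuffle a b) (cong (λ z → b + z) (trans eq (ℤ.*-comm c (+ 2))))
      where
      shuffle : ∀ a b → a ≡ b + (a - b)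
      shuffle = solve-∀
  ... | no k≰n = ⊥-elim (k≰n k≤n)

square-lift : ∀ {n a b} → a ≈[ + 2 , n ] b → a *ₛ a ≈[ + 4 , n ] b *ₛ b
square-lift {n} {a} {b} a≈b with halve a≈b
... | h , a≈b+2h = begin
  a *ₛ a                                           ≈⟨ *ₛ-cong a≈b+2h a≈b+2h ⟩
  (b +ₛ const (+ 2) *ₛ h) *ₛ (b +ₛ const (+ 2) *ₛ h)
    ≈⟨ solve 2 (λ b h → (b :+ con (+ 2) :* h) :* (b :+ con (+ 2) :* h) := b :* b :+ con (+ 4) :* (b :* h :+ h :* h)) ≈-refl b h ⟩
  b *ₛ b +ₛ const (+ 4) *ₛ (b *ₛ h +ₛ h *ₛ h)     ≈⟨ +ₛ-cong (≈-refl {f = b *ₛ b}) (const*ₛ≈0 (b *ₛ h +ₛ h *ₛ h)) ⟩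
  b *ₛ b +ₛ 0ₛ                                     ≈⟨ solve 1 (λ b → b :+ con 0ℤ := b) ≈-refl (b *ₛ b) ⟩
  b *ₛ b                                           ∎
  where open SeriesMod (+ 4) n

frobenius : ∀ n f → f *ₛ f ≈[ + 2 , n ] f ⟨x²⟩
frobenius zero f zero _ = square≡self[mod2] (f 0)
frobenius (suc n) f = begin
  f *ₛ f                                   ≈⟨ ≗⇒≈ (*ₛ-resp-≗ (head+X*tail f) (head+X*tail f)) ⟩
  (c +ₛ X *ₛ t) *ₛ (c +ₛ X *ₛ t)
    ≈⟨ solve 3 (λ c X t → (c :+ X :* t) :* (c :+ X :* t) := c :* c :+ X :* (X :* (t :* t)) :+ con (+ 2) :* (c :* X :* t))
             ≈-refl c X t ⟩
  c *ₛ c +ₛ X *ₛ (X *ₛ (t *ₛ t)) +ₛ const (+ 2) *ₛ (c *ₛ X *ₛ t)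
    ≈⟨ +ₛ-cong (+ₛ-cong c²≈c (≈-mono (ℕ.n≤1+n (suc n)) (X-*ₛ-shift (X-*ₛ-shift (frobenius n t))))) (const*ₛ≈0 (c *ₛ X *ₛ t)) ⟩
  c +ₛ X *ₛ (X *ₛ t ⟨x²⟩) +ₛ 0ₛ            ≈⟨ solve 2 (λ a b → a :+ b :+ con 0ℤ := a :+ b) ≈-refl c (X *ₛ (X *ₛ t ⟨x²⟩)) ⟩
  c +ₛ X *ₛ (X *ₛ t ⟨x²⟩)                  ≈⟨ ≗⇒≈ (⟨x²⟩-head+X²*tail f) ⟨
  f ⟨x²⟩                                    ∎
  where
  open SeriesMod (+ 2) (suc n)
  c t : Series
  c = const (f 0)
  t = tail f
  c²≈c : c *ₛ c ≈ c
  c²≈c = ≈-trans (≗⇒≈ (λ k → sym (const-*ₛ-const (f 0) (f 0) k))) (const-cong (square≡self[mod2] (f 0)))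

-- d_{2k} ≡ d_k and d_{2k+1} ≡ 0, so strong induction on the index.
⟨x²⟩-fixed⇒≈0 : ∀ {n d} → d ≈[ + 2 , n ] d ⟨x²⟩ → d 0 ≡ 0ℤ [mod + 2 ] → d ≈[ + 2 , n ] 0ₛ
⟨x²⟩-fixed⇒≈0 {n} {d} d≈d⟨x²⟩ d₀≡0 = <-rec (λ m → m ≤ n → d m ≡ 0ₛ m [mod + 2 ]) step
  where
  step : ∀ m → (∀ {k} → k < m → k ≤ n → d k ≡ 0ₛ k [mod + 2 ]) → m ≤ n → d m ≡ 0ₛ m [mod + 2 ]
  step m rec m≤n with parity m
  ... | even zero = d₀≡0
  ... | even (suc k) =
    mod-trans (d≈d⟨x²⟩ _ m≤n) (subst (_≡ 0ℤ [mod + 2 ]) (sym (⟨x²⟩-even d (suc k)))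
                                    (rec (n<double k) (ℕ.≤-trans (ℕ.<⇒≤ (n<double k)) m≤n)))
  ... | odd k = mod-trans (d≈d⟨x²⟩ _ m≤n) (mod-reflexive (⟨x²⟩-odd d k))

-- The Thue–Morse sequence

tmFuel-irrelevant : ∀ f f′ n → n ≤ f → n ≤ f′ → tmFuel f n ≡ tmFuel f′ n
tmFuel-irrelevant zero zero zero _ _ = refl
tmFuel-irrelevant zero (suc f′) zero _ _ = refl
tmFuel-irrelevant (suc f) zero zero _ _ = refl
tmFuel-irrelevant (suc f) (suc f′) zero _ _ = refl
tmFuel-irrelevant (suc f) (suc f′) (suc n) (s≤s n≤f) (s≤s n≤f′) =
  cong (λ z → if even? (suc n) then z else - z)
       (tmFuel-irrelevant f f′ ⌊ suc n /2⌋ (ℕ.≤-trans (half≤ n) n≤f) (ℕ.≤-trans (half≤ n) n≤f′))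
  where
  half≤ : ∀ n → ⌊ suc n /2⌋ ≤ n
  half≤ zero = z≤n
  half≤ (suc n) = s≤s (ℕ.⌊n/2⌋≤n n)

even?-double : ∀ k → even? (double k) ≡ true
even?-double zero = refl
even?-double (suc k) = even?-double k

even?-suc-double : ∀ k → even? (suc (double k)) ≡ false
even?-suc-double zero = refl
even?-suc-double (suc k) = even?-suc-double k

⌊double/2⌋ : ∀ k → ⌊ double k /2⌋ ≡ k
⌊double/2⌋ zero = refl
⌊double/2⌋ (suc k) = cong suc (⌊double/2⌋ k)

⌊suc-double/2⌋ : ∀ k → ⌊ suc (double k) /2⌋ ≡ k
⌊suc-double/2⌋ zero = refl
⌊suc-double/2⌋ (suc k) = cong suc (⌊suc-double/2⌋ k)

tm-double : ∀ k → tm (double k) ≡ tm k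
tm-double zero = refl
tm-double (suc k) rewrite even?-double k | ⌊double/2⌋ k =
  tmFuel-irrelevant (suc (double k)) (suc k) (suc k) (s≤s (n≤double k)) ℕ.≤-refl

tm-suc-double : ∀ k → tm (suc (double k)) ≡ - tm k
tm-suc-double k rewrite even?-suc-double k | ⌊suc-double/2⌋ k =
  cong -_ (tmFuel-irrelevant (double k) k k (n≤double k) ℕ.≤-refl)

tm≡±1 : ∀ j → tm j ≡ 1ℤ ⊎ tm j ≡ - 1ℤ
tm≡±1 j = tmFuel≡±1 j j
  where
  tmFuel≡±1 : ∀ f n → tmFuel f n ≡ 1ℤ ⊎ tmFuel f n ≡ - 1ℤ
  tmFuel≡±1 zero n = inj₁ refl
  tmFuel≡±1 (suc f) zero = inj₁ refl
  tmFuel≡±1 (suc f) (suc n) with even? (suc n) | tmFuel≡±1 f ⌊ suc n /2⌋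
  ... | true | r = r
  ... | false | inj₁ eq = inj₂ (cong -_ eq)
  ... | false | inj₂ eq = inj₁ (cong -_ eq)

signBit : ℤ → ℤ
signBit (+ _) = 0ℤ
signBit -[1+ _ ] = 1ℤ

tmBit : ℕ → ℤ
tmBit j = signBit (tm j)

tm≡1-2*tmBit : ∀ j → tm j ≡ 1ℤ - + 2 * tmBit j
tm≡1-2*tmBit j with tm j | tm≡±1 j
... | _ | inj₁ refl = refl
... | _ | inj₂ refl = refl

tmBit-double : ∀ k → tmBit (double k) ≡ tmBit k
tmBit-double k = cong signBit (tm-double k)

tmBit-suc-double : ∀ k → tmBit (suc (double k)) ≡ 1ℤ - tmBit k
tmBit-suc-double k rewrite tm-suc-double k with tm k | tm≡±1 k
... | _ | inj₁ refl = refl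
... | _ | inj₂ refl = refl

tmBit-idem : ∀ j → tmBit j * tmBit j ≡ tmBit j
tmBit-idem j with tm j | tm≡±1 j
... | _ | inj₁ refl = refl
... | _ | inj₂ refl = refl

sumUpTo-cong : ∀ M {f g : ℕ → ℤ} → (∀ i → i ≤ M → f i ≡ g i) → sumUpTo M f ≡ sumUpTo M g
sumUpTo-cong zero p = p 0 z≤n
sumUpTo-cong (suc M) p = cong₂ _+_ (p (suc M) ℕ.≤-refl) (sumUpTo-cong M (λ i i≤M → p i (ℕ.m≤n⇒m≤1+n i≤M)))

sumUpTo-zero : ∀ M {f : ℕ → ℤ} → (∀ i → i ≤ M → f i ≡ 0ℤ) → sumUpTo M f ≡ 0ℤ
sumUpTo-zero M p = trans (sumUpTo-cong M p) (sumUpTo-0 M)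
  where
  sumUpTo-0 : ∀ M → sumUpTo M (λ _ → 0ℤ) ≡ 0ℤ
  sumUpTo-0 zero = refl
  sumUpTo-0 (suc M) = trans (ℤ.+-identityˡ _) (sumUpTo-0 M)

sumUpTo-suc : ∀ M (f : ℕ → ℤ) → sumUpTo (suc M) f ≡ f 0 + sumUpTo M (λ i → f (suc i))
sumUpTo-suc zero f = ℤ.+-comm (f 1) (f 0)
sumUpTo-suc (suc M) f =
  trans (cong (λ z → f (suc (suc M)) + z) (sumUpTo-suc M f)) (swap (f (suc (suc M))) (f 0) (sumUpTo M (λ i → f (suc i))))
  where
  swap : ∀ a b c → a + (b + c) ≡ b + (a + c)
  swap = solve-∀

sumUpTo-shrink : ∀ {a} M (f : ℕ → ℤ) → a ≤ M → (∀ i → a < i → i ≤ M → f i ≡ 0ℤ) → sumUpTo M f ≡ sumUpTo a f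
sumUpTo-shrink M f a≤M p with ℕ.m≤n⇒m<n∨m≡n a≤M
... | inj₂ refl = refl
sumUpTo-shrink (suc M) f _ p | inj₁ (s≤s a≤M) =
  trans (cong₂ _+_ (p (suc M) (s≤s a≤M) ℕ.≤-refl) (sumUpTo-shrink M f a≤M (λ i a<i i≤M → p i a<i (ℕ.m≤n⇒m≤1+n i≤M))))
        (ℤ.+-identityˡ _)

sumUpTo-+ : ∀ M (f g : ℕ → ℤ) → sumUpTo M (λ i → f i + g i) ≡ sumUpTo M f + sumUpTo M g
sumUpTo-+ zero f g = refl
sumUpTo-+ (suc M) f g =
  trans (cong (λ z → f (suc M) + g (suc M) + z) (sumUpTo-+ M f g)) (interchange (f (suc M)) (g (suc M)) (sumUpTo M f) (sumUpTo M g))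
  where
  interchange : ∀ a b c d → a + b + (c + d) ≡ a + c + (b + d)
  interchange = solve-∀

sumUpTo-*ʳ : ∀ M (f : ℕ → ℤ) c → sumUpTo M f * c ≡ sumUpTo M (λ i → f i * c)
sumUpTo-*ʳ zero f c = refl
sumUpTo-*ʳ (suc M) f c = trans (ℤ.*-distribʳ-+ c (f (suc M)) (sumUpTo M f)) (cong (λ z → f (suc M) * c + z) (sumUpTo-*ʳ M f c))

sumUpTo-swap : ∀ M N (F : ℕ → ℕ → ℤ) → sumUpTo M (λ a → sumUpTo N (F a)) ≡ sumUpTo N (λ i → sumUpTo M (λ a → F a i))
sumUpTo-swap zero N F = refl
sumUpTo-swap (suc M) N F = trans (cong (λ z → sumUpTo N (F (suc M)) + z) (sumUpTo-swap M N F))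
                                 (sym (sumUpTo-+ N (F (suc M)) (λ i → sumUpTo M (λ a → F a i))))

ind-≢ : ∀ {a b} → a ≢ b → ind (a ≡ᵇ b) ≡ 0ℤ
ind-≢ {a} {b} a≢b with a ≡ᵇ b in eq
... | true = ⊥-elim (a≢b (ℕ.≡ᵇ⇒≡ a b (subst T (sym eq) tt)))
... | false = refl

ind-refl : ∀ a → ind (a ≡ᵇ a) ≡ 1ℤ
ind-refl a with a ≡ᵇ a in eq
... | true = refl
... | false = ⊥-elim (subst T eq (ℕ.≡⇒≡ᵇ a a refl))

ind-cong : ∀ {a b c d} → (a ≡ b → c ≡ d) → (c ≡ d → a ≡ b) → ind (a ≡ᵇ b) ≡ ind (c ≡ᵇ d)
ind-cong {a} {b} {c} {d} to from with a ℕ.≟ b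
... | yes refl = trans (ind-refl a) (sym (subst (λ z → ind (c ≡ᵇ z) ≡ 1ℤ) (to refl) (ind-refl c)))
... | no a≢b = trans (ind-≢ a≢b) (sym (ind-≢ (λ c≡d → a≢b (from c≡d))))

sumUpTo-delta-out : ∀ M {c} (h : ℕ → ℤ) → M < c → sumUpTo M (λ a → ind (c ≡ᵇ a) * h a) ≡ 0ℤ
sumUpTo-delta-out M h M<c = sumUpTo-zero M λ i i≤M →
  trans (cong (_* h i) (ind-≢ (λ c≡i → ℕ.<⇒≢ (ℕ.≤-<-trans i≤M M<c) (sym c≡i)))) (ℤ.*-zeroˡ (h i))

sumUpTo-delta : ∀ M {c} (h : ℕ → ℤ) → c ≤ M → sumUpTo M (λ a → ind (c ≡ᵇ a) * h a) ≡ h c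
sumUpTo-delta zero {zero} h _ = ℤ.*-identityˡ (h 0)
sumUpTo-delta (suc M) {c} h c≤M with ℕ.m≤n⇒m<n∨m≡n c≤M
... | inj₂ refl = trans (cong₂ _+_ (trans (cong (_* h c) (ind-refl c)) (ℤ.*-identityˡ (h c))) (sumUpTo-delta-out M h ℕ.≤-refl))
                        (ℤ.+-identityʳ _)
... | inj₁ (s≤s c≤M′) = trans (cong₂ _+_ (trans (cong (_* h (suc M)) (ind-≢ (ℕ.<⇒≢ (s≤s c≤M′)))) (ℤ.*-zeroˡ (h (suc M))))
                                         (sumUpTo-delta M h c≤M′))
                              (ℤ.+-identityˡ _)


count : (ℕ → ℕ) → Series
count g m = sumUpTo m (λ i → ind (g i ≡ᵇ m))

module _ {g : ℕ → ℕ} (n<g : ∀ i → i < g i) where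

  count-extend : ∀ {m} M → m ≤ M → sumUpTo M (λ i → ind (g i ≡ᵇ m)) ≡ count g m
  count-extend {m} M m≤M = sumUpTo-shrink M _ m≤M (λ i m<i _ → ind-≢ (λ gi≡m → ℕ.<⇒≢ (ℕ.<-trans m<i (n<g i)) (sym gi≡m)))

  count-zero : ∀ {m} → (∀ i → g i ≢ m) → count g m ≡ 0ℤ
  count-zero {m} g≢m = sumUpTo-zero m (λ i _ → ind-≢ (g≢m i))

  -- If g (i + 1) = h (g i) for an injective h, the solutions of g i = h a are the successors of those of g i = a.
  count-image : ∀ {h : ℕ → ℕ} → (∀ i → g (suc i) ≡ h (g i)) → (∀ {a b} → h a ≡ h b → a ≡ b) →
                ∀ {a M} → h a ≡ suc M → g 0 ≢ h a → a ≤ M → count g (h a) ≡ count g a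
  count-image {h} g-suc h-inj {a} {M} ha≡1+M g₀≢ha a≤M = begin
    count g (h a)                                         ≡⟨ cong (λ N → sumUpTo N (λ i → ind (g i ≡ᵇ h a))) ha≡1+M ⟩
    sumUpTo (suc M) (λ i → ind (g i ≡ᵇ h a))             ≡⟨ sumUpTo-suc M (λ i → ind (g i ≡ᵇ h a)) ⟩
    ind (g 0 ≡ᵇ h a) + sumUpTo M (λ i → ind (g (suc i) ≡ᵇ h a))
      ≡⟨ cong₂ _+_ (ind-≢ g₀≢ha)
              (sumUpTo-cong M (λ i _ → ind-cong (λ eq → h-inj (trans (sym (g-suc i)) eq)) (λ eq → trans (g-suc i) (cong h eq)))) ⟩
    0ℤ + sumUpTo M (λ i → ind (g i ≡ᵇ a))               ≡⟨ ℤ.+-identityˡ _ ⟩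
    sumUpTo M (λ i → ind (g i ≡ᵇ a))                     ≡⟨ count-extend M a≤M ⟩
    count g a                                             ∎
    where open ≡-Reasoning

n<2^n : ∀ i → i < 2 ^ i
n<2^n zero = s≤s z≤n
n<2^n (suc i) = ℕ.+-mono-≤ {1} {2 ^ i} (ℕ.m^n>0 2 i) (ℕ.≤-trans (n<2^n i) (ℕ.m≤m+n (2 ^ i) 0))

2^suc≡double : ∀ i → 2 ^ suc i ≡ double (2 ^ i)
2^suc≡double i = sym (double≡2* (2 ^ i))

4^_ : ℕ → ℕ
4^ k = 2 ^ (2 ℕ.* k)

4^suc≡double² : ∀ i → 4^ suc i ≡ double (double (4^ i))
4^suc≡double² i = trans (cong (2 ^_) (ℕ.*-suc 2 i))
                        (trans (sym (double≡2* (2 ^ suc (2 ℕ.* i)))) (cong double (sym (double≡2* (4^ i)))))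

n<4^n : ∀ i → i < 4^ i
n<4^n i = ℕ.≤-<-trans (ℕ.m≤n*m i 2) (n<2^n (2 ℕ.* i))

1≢double-suc : ∀ {k} → 1 ≢ double (suc k)
1≢double-suc ()

1≢odd-suc : ∀ {k} → 1 ≢ suc (double (suc k))
1≢odd-suc ()


s : Series
s = count (2 ^_)

s-odd : ∀ k → s (suc (double (suc k))) ≡ 0ℤ
s-odd k = count-zero n<2^n λ
  { zero → 1≢odd-suc
  ; (suc i) eq → double≢odd (2 ^ i) (suc k) (trans (sym (2^suc≡double i)) eq) }

s-double : ∀ k → s (double (suc k)) ≡ s (suc k)
s-double k = count-image n<2^n 2^suc≡double double-injective refl 1≢double-suc (s≤s (n≤double k))

s≗X+s⟨x²⟩ : s ≗ X +ₛ s ⟨x²⟩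
s≗X+s⟨x²⟩ m with parity m
... | even zero = refl
... | even (suc k) = trans (s-double k) (sym (trans (ℤ.+-identityˡ _) (⟨x²⟩-even s (suc k))))
... | odd zero = refl
... | odd (suc k) = trans (s-odd k) (sym (trans (ℤ.+-identityˡ _) (⟨x²⟩-odd s (suc k))))


fourPowCount-odd : ∀ k → fourPowCount (suc (double (suc k))) ≡ 0ℤ
fourPowCount-odd k = count-zero n<4^n λ
  { zero → 1≢odd-suc
  ; (suc i) eq → double≢odd (double (4^ i)) (suc k) (trans (sym (4^suc≡double² i)) eq) }

fourPowCount-2mod4 : ∀ k → fourPowCount (double (suc (double k))) ≡ 0ℤ
fourPowCount-2mod4 k = count-zero n<4^n λ
  { zero → 1≢double-suc
  ; (suc i) eq → double≢odd (4^ i) k (double-injective (trans (sym (4^suc≡double² i)) eq)) }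

fourPowCount-4* : ∀ k → fourPowCount (double (double (suc k))) ≡ fourPowCount (suc k)
fourPowCount-4* k = count-image n<4^n 4^suc≡double² (λ eq → double-injective (double-injective eq)) refl 1≢double-suc
                                (s≤s (ℕ.m≤n⇒m≤1+n (ℕ.m≤n⇒m≤1+n (ℕ.≤-trans (n≤double k) (n≤double (double k))))))

fourPowCount+⟨x²⟩≗s : fourPowCount +ₛ fourPowCount ⟨x²⟩ ≗ s
fourPowCount+⟨x²⟩≗s = <-rec (λ m → (fourPowCount +ₛ fourPowCount ⟨x²⟩) m ≡ s m) step
  where
  P : Series
  P = fourPowCount
  step : ∀ m → (∀ {k} → k < m → (P +ₛ P ⟨x²⟩) k ≡ s k) → (P +ₛ P ⟨x²⟩) m ≡ s m
  step m rec with parity m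
  ... | even zero = refl
  ... | odd zero = refl
  ... | odd (suc k) = trans (cong₂ _+_ (fourPowCount-odd k) (⟨x²⟩-odd P (suc k))) (sym (s-odd k))
  step _ rec | even (suc k) with parity k
  ... | even j = begin
    P (double (suc (double j))) + (P ⟨x²⟩) (double (suc (double j)))
      ≡⟨ cong₂ _+_ (fourPowCount-2mod4 j) (⟨x²⟩-even P (suc (double j))) ⟩
    0ℤ + P (suc (double j))                                  ≡⟨ ℤ.+-identityˡ _ ⟩
    P (suc (double j))                                       ≡⟨ ℤ.+-identityʳ _ ⟨
    P (suc (double j)) + 0ℤ                                  ≡⟨ cong (λ z → P (suc (double j)) + z) (⟨x²⟩-odd P j) ⟨
    (P +ₛ P ⟨x²⟩) (suc (double j))                           ≡⟨ rec (n<double (double j)) ⟩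
    s (suc (double j))                                       ≡⟨ s-double (double j) ⟨
    s (double (suc (double j)))                              ∎
    where open ≡-Reasoning
  ... | odd j = begin
    P (double (double (suc j))) + (P ⟨x²⟩) (double (double (suc j)))
      ≡⟨ cong₂ _+_ (fourPowCount-4* j) (⟨x²⟩-even P (double (suc j))) ⟩
    P (suc j) + P (double (suc j))                           ≡⟨ ℤ.+-comm (P (suc j)) (P (double (suc j))) ⟩
    P (double (suc j)) + P (suc j)                           ≡⟨ cong (λ z → P (double (suc j)) + z) (⟨x²⟩-even P (suc j)) ⟨
    (P +ₛ P ⟨x²⟩) (double (suc j))                           ≡⟨ rec (n<double (suc (double j))) ⟩
    s (double (suc j))                                       ≡⟨ s-double (suc (double j)) ⟨
    s (double (double (suc j)))                              ∎
    where open ≡-Reasoning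


convAux≡sumUpTo : ∀ f g m k → convAux f g m k ≡ sumUpTo k (λ i → f i * g (m ∸ i))
convAux≡sumUpTo f g m zero = refl
convAux≡sumUpTo f g m (suc k) = cong (λ z → f (suc k) * g (m ∸ suc k) + z) (convAux≡sumUpTo f g m k)

s²≡pairCount : ∀ m → (s *ₛ s) (suc m) ≡ pairCount m
s²≡pairCount m = begin
  (s *ₛ s) (suc m)                                          ≡⟨ convAux≡sumUpTo s s (suc m) (suc m) ⟩
  sumUpTo (suc m) (λ a → s a * s (suc m ∸ a))
    ≡⟨ sumUpTo-cong (suc m) (λ a a≤1+m → trans (cong (_* s (suc m ∸ a)) (sym (count-extend n<2^n (suc m) a≤1+m)))
                                                (sumUpTo-*ʳ (suc m) (λ i → ind (2 ^ i ≡ᵇ a)) (s (suc m ∸ a)))) ⟩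
  sumUpTo (suc m) (λ a → sumUpTo (suc m) (λ i → ind (2 ^ i ≡ᵇ a) * s (suc m ∸ a)))
    ≡⟨ sumUpTo-swap (suc m) (suc m) (λ a i → ind (2 ^ i ≡ᵇ a) * s (suc m ∸ a)) ⟩
  sumUpTo (suc m) (λ i → sumUpTo (suc m) (λ a → ind (2 ^ i ≡ᵇ a) * s (suc m ∸ a)))
    ≡⟨ cong (λ z → z + sumUpTo m (λ i → sumUpTo (suc m) (λ a → ind (2 ^ i ≡ᵇ a) * s (suc m ∸ a))))
            (sumUpTo-delta-out (suc m) (λ a → s (suc m ∸ a)) (n<2^n (suc m))) ⟩
  0ℤ + sumUpTo m (λ i → sumUpTo (suc m) (λ a → ind (2 ^ i ≡ᵇ a) * s (suc m ∸ a)))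
    ≡⟨ ℤ.+-identityˡ _ ⟩
  sumUpTo m (λ i → sumUpTo (suc m) (λ a → ind (2 ^ i ≡ᵇ a) * s (suc m ∸ a)))
    ≡⟨ sumUpTo-cong m (λ i _ → inner i) ⟩
  pairCount m                                               ∎
  where
  open ≡-Reasoning
  inner : ∀ i → sumUpTo (suc m) (λ a → ind (2 ^ i ≡ᵇ a) * s (suc m ∸ a)) ≡ sumUpTo m (λ j → ind ((2 ^ i ℕ.+ 2 ^ j) ≡ᵇ suc m))
  inner i with 2 ^ i ℕ.≤? suc m
  ... | yes 2^i≤1+m = trans (sumUpTo-delta (suc m) (λ a → s (suc m ∸ a)) 2^i≤1+m) (sym (begin
    sumUpTo m (λ j → ind ((2 ^ i ℕ.+ 2 ^ j) ≡ᵇ suc m))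
      ≡⟨ sumUpTo-cong m (λ j _ → ind-cong (λ eq → trans (sym (ℕ.m+n∸m≡n (2 ^ i) (2 ^ j))) (cong (_∸ 2 ^ i) eq))
                                         (λ eq → trans (cong (2 ^ i ℕ.+_) eq) (ℕ.m+[n∸m]≡n 2^i≤1+m))) ⟩
    sumUpTo m (λ j → ind (2 ^ j ≡ᵇ (suc m ∸ 2 ^ i)))
      ≡⟨ count-extend n<2^n m (ℕ.∸-monoʳ-≤ (suc m) (ℕ.m^n>0 2 i)) ⟩
    s (suc m ∸ 2 ^ i) ∎))
  ... | no 2^i≰1+m = trans (sumUpTo-delta-out (suc m) (λ a → s (suc m ∸ a)) (ℕ.≰⇒> 2^i≰1+m))
                           (sym (sumUpTo-zero m (λ j _ → ind-≢ (λ eq → 2^i≰1+m (subst (2 ^ i ≤_) eq (ℕ.m≤m+n (2 ^ i) (2 ^ j)))))))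

-- The continued fraction with all t_j = 1, modulo 4

R : Series
R m = 1ₛ m - pairCount m

X*R≗X-s² : X *ₛ R ≗ X -ₛ s *ₛ s
X*R≗X-s² zero = refl
X*R≗X-s² (suc m) = trans (X-*ₛ-suc R m) (cong₂ _-_ (1ₛ≡X-suc m) (sym (s²≡pairCount m)))
  where
  1ₛ≡X-suc : ∀ m → 1ₛ m ≡ X (suc m)
  1ₛ≡X-suc zero = refl
  1ₛ≡X-suc (suc m) = refl

-- With σ = f(x²) and t = (x + σ)², Frobenius gives t ≡ σ (mod 2), so 2xt ≡ 2xσ and t² ≡ σ² (mod 4).
X-f²-fixpoint : ∀ {n} f → f ≗ X +ₛ f ⟨x²⟩ → (X -ₛ f *ₛ f) +ₛ (X -ₛ f *ₛ f) *ₛ (X -ₛ f *ₛ f) ≈[ + 4 , n ] X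
X-f²-fixpoint {n} f f≗X+σ = begin
  a +ₛ a *ₛ a                                                  ≈⟨ +ₛ-cong a≈X-t (*ₛ-cong a≈X-t a≈X-t) ⟩
  (X -ₛ t) +ₛ (X -ₛ t) *ₛ (X -ₛ t)
    ≈⟨ solve 2 (λ X t → (X :- t) :+ (X :- t) :* (X :- t) := X :- t :+ X :* X :- con (+ 2) :* (X :* t) :+ t :* t) ≈-refl X t ⟩
  X -ₛ t +ₛ X *ₛ X -ₛ const (+ 2) *ₛ (X *ₛ t) +ₛ t *ₛ t
    ≈⟨ +ₛ-cong (+ₛ-cong (≈-refl {f = X -ₛ t +ₛ X *ₛ X}) (-ₛ-cong (2*ₛ-lift (*ₛ-cong (≈-refl {f = X}) t≈σ)))) (square-lift t≈σ) ⟩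
  X -ₛ t +ₛ X *ₛ X -ₛ const (+ 2) *ₛ (X *ₛ σ) +ₛ σ *ₛ σ
    ≈⟨ solve 2 (λ X σ → X :- (X :+ σ) :* (X :+ σ) :+ X :* X :- con (+ 2) :* (X :* σ) :+ σ :* σ := X :- con (+ 4) :* (X :* σ))
             ≈-refl X σ ⟩
  X -ₛ const (+ 4) *ₛ (X *ₛ σ)                                 ≈⟨ +ₛ-cong (≈-refl {f = X}) (-ₛ-cong (const*ₛ≈0 (X *ₛ σ))) ⟩
  X -ₛ 0ₛ                                                      ≈⟨ solve 1 (λ X → X :- con 0ℤ := X) ≈-refl X ⟩
  X                                                            ∎
  where
  open SeriesMod (+ 4) n
  σ t a : Series
  σ = f ⟨x²⟩
  t = (X +ₛ σ) *ₛ (X +ₛ σ)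
  a = X -ₛ f *ₛ f
  f²≈t : ∀ {q} → f *ₛ f ≈[ q , n ] t
  f²≈t = ≗⇒≈ (*ₛ-resp-≗ f≗X+σ f≗X+σ)
  a≈X-t : a ≈ X -ₛ t
  a≈X-t = +ₛ-cong (≈-refl {f = X}) (-ₛ-cong f²≈t)
  t≈σ : t ≈[ + 2 , n ] σ
  t≈σ = ≈-trans (≈-sym f²≈t) (frobenius n f)

R-fixpoint : ∀ n → R *ₛ (1ₛ +ₛ X *ₛ R) ≈[ + 4 , n ] 1ₛ
R-fixpoint n = X-*ₛ-cancel (begin
  X *ₛ (R *ₛ (1ₛ +ₛ X *ₛ R))      ≈⟨ solve 2 (λ X R → X :* (R :* (con 1ℤ :+ X :* R)) := X :* R :+ (X :* R) :* (X :* R)) ≈-refl X R ⟩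
  X *ₛ R +ₛ (X *ₛ R) *ₛ (X *ₛ R)  ≈⟨ +ₛ-cong XR≈a (*ₛ-cong XR≈a XR≈a) ⟩
  a +ₛ a *ₛ a                      ≈⟨ X-f²-fixpoint s s≗X+s⟨x²⟩ ⟩
  X                                ≈⟨ solve 1 (λ X → X := X :* con 1ℤ) ≈-refl X ⟩
  X *ₛ 1ₛ                          ∎)
  where
  open SeriesMod (+ 4) (suc n)
  a : Series
  a = X -ₛ s *ₛ s
  XR≈a : X *ₛ R ≈ a
  XR≈a = ≗⇒≈ X*R≗X-s²

-- The truncations modulo 4

infixr 8 _^ₛ_
_^ₛ_ : Series → ℕ → Series
y ^ₛ zero = 1ₛ
y ^ₛ suc i = y *ₛ y ^ₛ i

-- bitPoly j y r = Σ_{k=1}^{r} tmBit (j + k - 1) y^k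
bitPoly : ℕ → Series → ℕ → Series
bitPoly j y zero = 0ₛ
bitPoly j y (suc r) = bitPoly j y r +ₛ const (tmBit (j ℕ.+ r)) *ₛ y ^ₛ suc r

module _ {q : ℤ} {n : ℕ} where
  open SeriesMod q n

  bitPoly-horner : ∀ j y r → bitPoly j y (suc r) ≈ y *ₛ (const (tmBit j) +ₛ bitPoly (suc j) y r)
  bitPoly-horner j y zero = begin
    0ₛ +ₛ const (tmBit (j ℕ.+ 0)) *ₛ (y *ₛ 1ₛ)   ≡⟨ cong (λ i → 0ₛ +ₛ const (tmBit i) *ₛ (y *ₛ 1ₛ)) (ℕ.+-identityʳ j) ⟩
    0ₛ +ₛ const (tmBit j) *ₛ (y *ₛ 1ₛ)
      ≈⟨ solve 2 (λ c y → con 0ℤ :+ c :* (y :* con 1ℤ) := y :* (c :+ con 0ℤ)) ≈-refl (const (tmBit j)) y ⟩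
    y *ₛ (const (tmBit j) +ₛ 0ₛ)                 ∎
  bitPoly-horner j y (suc r) = begin
    bitPoly j y (suc r) +ₛ d *ₛ (y *ₛ p)
      ≈⟨ +ₛ-cong (bitPoly-horner j y r) (≈-refl {f = d *ₛ (y *ₛ p)}) ⟩
    y *ₛ (c +ₛ B) +ₛ d *ₛ (y *ₛ p)               ≡⟨ cong (λ i → y *ₛ (c +ₛ B) +ₛ const (tmBit i) *ₛ (y *ₛ p)) (ℕ.+-suc j r) ⟩
    y *ₛ (c +ₛ B) +ₛ d′ *ₛ (y *ₛ p)              ≈⟨ solve 5 (λ y c B d p → y :* (c :+ B) :+ d :* (y :* p) := y :* (c :+ (B :+ d :* p)))
                                                          ≈-refl y c B d′ p ⟩
    y *ₛ (c +ₛ (B +ₛ d′ *ₛ p))                   ∎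
    where
    c B d d′ p : Series
    c = const (tmBit j)
    B = bitPoly (suc j) y r
    d = const (tmBit (j ℕ.+ suc r))
    d′ = const (tmBit (suc j ℕ.+ r))
    p = y ^ₛ suc r

u : Series
u = X *ₛ R *ₛ R

const-tm≗1-2*tmBit : ∀ j → const (tm j) ≗ 1ₛ -ₛ const (+ 2) *ₛ const (tmBit j)
const-tm≗1-2*tmBit j zero = tm≡1-2*tmBit j
const-tm≗1-2*tmBit j (suc k) = sym (cong (λ z → 0ℤ - z) (trans (const-*ₛ (+ 2) (const (tmBit j)) (suc k)) (ℤ.*-zeroʳ (+ 2))))

-- If the tail starting at t_{j+1} is R + 2 R B, then using t_j = 1 - 2 tmBit j and R (1 + x R) ≡ 1
-- the tail starting at t_j is 1 / (1 + t_j x (R + 2 R B)) ≡ R + 2 R u (tmBit j + B) modulo 4.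
inv-H-mod4 : ∀ r j → inv (H r j) ≈[ + 4 , r ] R +ₛ const (+ 2) *ₛ (R *ₛ bitPoly j u r)
inv-H-mod4 zero j zero z≤n = mod-refl
inv-H-mod4 (suc r) j = ≈-sym (inv-unique refl (begin
  (R +ₛ const (+ 2) *ₛ (R *ₛ bitPoly j u (suc r))) *ₛ H (suc r) j
    ≈⟨ *ₛ-cong (+ₛ-cong (≈-refl {f = R}) (*ₛ-cong (≈-refl {f = const (+ 2)}) (*ₛ-cong (≈-refl {f = R}) (bitPoly-horner j u r))))
               (≗⇒≈ (onePlusXTimes-≗ (tm j) (inv (H r (suc j))))) ⟩
  (R +ₛ const (+ 2) *ₛ (R *ₛ (u *ₛ (c +ₛ B)))) *ₛ (1ₛ +ₛ const (tm j) *ₛ (X *ₛ inv (H r (suc j))))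
    ≈⟨ *ₛ-cong (≈-refl {f = R +ₛ const (+ 2) *ₛ (R *ₛ (u *ₛ (c +ₛ B)))})
               (+ₛ-cong (≈-refl {f = 1ₛ}) (*ₛ-cong (≗⇒≈ (const-tm≗1-2*tmBit j)) (X-*ₛ-shift (inv-H-mod4 r (suc j))))) ⟩
  (R +ₛ const (+ 2) *ₛ (R *ₛ (u *ₛ (c +ₛ B)))) *ₛ (1ₛ +ₛ (1ₛ -ₛ const (+ 2) *ₛ c) *ₛ (X *ₛ (R +ₛ const (+ 2) *ₛ (R *ₛ B))))
    ≈⟨ solve 4 (λ X R c B →
         (R :+ con (+ 2) :* (R :* ((X :* R :* R) :* (c :+ B)))) :* (con 1ℤ :+ (con 1ℤ :- con (+ 2) :* c) :* (X :* (R :+ con (+ 2) :* (R :* B))))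
         := R :* (con 1ℤ :+ X :* R) :* (con 1ℤ :+ con (+ 2) :* ((X :* R :* R) :* (c :+ B))) :+ con (+ 2) :* ((X :* R :* R) :* (B :- c))
            :+ con (+ 4) :* (((X :* R :* R) :* (X :* R :* R)) :* ((c :+ B) :* (B :- c) :- con (+ 2) :* (c :* (c :+ B) :* B))
                             :- c :* (X :* R :* R) :* B))
         ≈-refl X R c B ⟩
  K *ₛ (1ₛ +ₛ const (+ 2) *ₛ (u *ₛ (c +ₛ B))) +ₛ const (+ 2) *ₛ (u *ₛ (B -ₛ c)) +ₛ const (+ 4) *ₛ Z
    ≈⟨ +ₛ-cong (+ₛ-cong (*ₛ-cong (R-fixpoint (suc r)) ≈-refl) ≈-refl) (const*ₛ≈0 Z) ⟩
  1ₛ *ₛ (1ₛ +ₛ const (+ 2) *ₛ (u *ₛ (c +ₛ B))) +ₛ const (+ 2) *ₛ (u *ₛ (B -ₛ c)) +ₛ 0ₛ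
    ≈⟨ solve 3 (λ u c B → con 1ℤ :* (con 1ℤ :+ con (+ 2) :* (u :* (c :+ B))) :+ con (+ 2) :* (u :* (B :- c)) :+ con 0ℤ
                          := con 1ℤ :+ con (+ 4) :* (u :* B)) ≈-refl u c B ⟩
  1ₛ +ₛ const (+ 4) *ₛ (u *ₛ B)                ≈⟨ +ₛ-cong (≈-refl {f = 1ₛ}) (const*ₛ≈0 (u *ₛ B)) ⟩
  1ₛ +ₛ 0ₛ                                     ≈⟨ solve 0 (con 1ℤ :+ con 0ℤ := con 1ℤ) ≈-refl ⟩
  1ₛ                                           ∎))
  where
  open SeriesMod (+ 4) (suc r)
  c B K Z : Series
  c = const (tmBit j)
  B = bitPoly (suc j) u r
  K = R *ₛ (1ₛ +ₛ X *ₛ R)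
  Z = (u *ₛ u) *ₛ ((c +ₛ B) *ₛ (B -ₛ c) -ₛ const (+ 2) *ₛ (c *ₛ (c +ₛ B) *ₛ B)) -ₛ c *ₛ u *ₛ B

-- Reduction modulo 2

geom : Series → ℕ → Series
geom y zero = 1ₛ
geom y (suc N) = geom y N +ₛ y ^ₛ suc N

module _ {q : ℤ} {n : ℕ} where
  open SeriesMod q n

  ^ₛ-double : ∀ y N → y ^ₛ double N ≈ (y *ₛ y) ^ₛ N
  ^ₛ-double y zero = ≈-refl
  ^ₛ-double y (suc N) = begin
    y *ₛ (y *ₛ y ^ₛ double N)      ≈⟨ *ₛ-cong (≈-refl {f = y}) (*ₛ-cong (≈-refl {f = y}) (^ₛ-double y N)) ⟩
    y *ₛ (y *ₛ (y *ₛ y) ^ₛ N)      ≈⟨ solve 2 (λ y p → y :* (y :* p) := (y :* y) :* p) ≈-refl y ((y *ₛ y) ^ₛ N) ⟩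
    (y *ₛ y) *ₛ (y *ₛ y) ^ₛ N      ∎

  ^ₛ-square : ∀ y N → y ^ₛ N *ₛ y ^ₛ N ≈ (y *ₛ y) ^ₛ N
  ^ₛ-square y zero = solve 0 (con 1ℤ :* con 1ℤ := con 1ℤ) ≈-refl
  ^ₛ-square y (suc N) = begin
    (y *ₛ y ^ₛ N) *ₛ (y *ₛ y ^ₛ N)      ≈⟨ solve 2 (λ y p → (y :* p) :* (y :* p) := (y :* y) :* (p :* p)) ≈-refl y (y ^ₛ N) ⟩
    (y *ₛ y) *ₛ (y ^ₛ N *ₛ y ^ₛ N)      ≈⟨ *ₛ-cong (≈-refl {f = y *ₛ y}) (^ₛ-square y N) ⟩
    (y *ₛ y) *ₛ (y *ₛ y) ^ₛ N           ∎

  geom-telescope : ∀ y N → (1ₛ -ₛ y) *ₛ geom y N ≈ 1ₛ -ₛ y ^ₛ suc N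
  geom-telescope y zero = solve 1 (λ y → (con 1ℤ :- y) :* con 1ℤ := con 1ℤ :- y :* con 1ℤ) ≈-refl y
  geom-telescope y (suc N) = begin
    (1ₛ -ₛ y) *ₛ (geom y N +ₛ y ^ₛ suc N)
      ≈⟨ solve 3 (λ y S p → (con 1ℤ :- y) :* (S :+ p) := (con 1ℤ :- y) :* S :+ (con 1ℤ :- y) :* p) ≈-refl y (geom y N) (y ^ₛ suc N) ⟩
    (1ₛ -ₛ y) *ₛ geom y N +ₛ (1ₛ -ₛ y) *ₛ y ^ₛ suc N   ≈⟨ +ₛ-cong (geom-telescope y N) ≈-refl ⟩
    1ₛ -ₛ y ^ₛ suc N +ₛ (1ₛ -ₛ y) *ₛ y ^ₛ suc N
      ≈⟨ solve 2 (λ y p → con 1ℤ :- p :+ (con 1ℤ :- y) :* p := con 1ℤ :- y :* p) ≈-refl y (y ^ₛ suc N) ⟩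
    1ₛ -ₛ y *ₛ y ^ₛ suc N                                ∎

  -- Since tmBit (2k) = tmBit k and tmBit (2k + 1) = 1 - tmBit k.
  bitPoly-split : ∀ y N → bitPoly 1 y (suc (double N)) ≈ bitPoly 1 (y *ₛ y) N +ₛ y *ₛ (geom (y *ₛ y) N -ₛ bitPoly 1 (y *ₛ y) N)
  bitPoly-split y zero = solve 1 (λ y → con 0ℤ :+ con 1ℤ :* (y :* con 1ℤ) := con 0ℤ :+ y :* (con 1ℤ :- con 0ℤ)) ≈-refl y
  bitPoly-split y (suc N) = begin
    bitPoly 1 y (suc (double N)) +ₛ const (tmBit (double (suc N))) *ₛ y ^ₛ double (suc N)
      +ₛ const (tmBit (suc (double (suc N)))) *ₛ (y *ₛ y ^ₛ double (suc N))
      ≈⟨ +ₛ-cong (+ₛ-cong (bitPoly-split y N)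
                           (*ₛ-cong (≗⇒≈ (λ k → cong (λ b → const b k) (tmBit-double (suc N)))) (^ₛ-double y (suc N))))
                 (*ₛ-cong (≗⇒≈ (λ k → trans (cong (λ b → const b k) (tmBit-suc-double (suc N))) (const-+ₛ 1ℤ (- tmBit (suc N)) k)))
                          (*ₛ-cong (≈-refl {f = y}) (^ₛ-double y (suc N)))) ⟩
    A +ₛ y *ₛ (S -ₛ A) +ₛ c *ₛ p +ₛ (1ₛ +ₛ const (- tmBit (suc N))) *ₛ (y *ₛ p)
      ≈⟨ +ₛ-cong (≈-refl {f = A +ₛ y *ₛ (S -ₛ A) +ₛ c *ₛ p})
                 (*ₛ-cong (+ₛ-cong (≈-refl {f = 1ₛ}) (≗⇒≈ (const-neg (tmBit (suc N))))) ≈-refl) ⟩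
    A +ₛ y *ₛ (S -ₛ A) +ₛ c *ₛ p +ₛ (1ₛ -ₛ c) *ₛ (y *ₛ p)
      ≈⟨ solve 5 (λ A S c p y → A :+ y :* (S :- A) :+ c :* p :+ (con 1ℤ :- c) :* (y :* p)
                             := (A :+ c :* p) :+ y :* ((S :+ p) :- (A :+ c :* p))) ≈-refl A S c p y ⟩
    (A +ₛ c *ₛ p) +ₛ y *ₛ ((S +ₛ p) -ₛ (A +ₛ c *ₛ p))     ∎
    where
    A S c p : Series
    A = bitPoly 1 (y *ₛ y) N
    S = geom (y *ₛ y) N
    c = const (tmBit (suc N))
    p = (y *ₛ y) ^ₛ suc N

u*≈X* : ∀ {q n} g → u *ₛ g ≈[ q , n ] X *ₛ (R *ₛ R *ₛ g)
u*≈X* {q} {n} g = solve 3 (λ X R g → X :* R :* R :* g := X :* (R :* R :* g)) ≈-refl X R g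
  where open SeriesMod q n

u^suc≈0 : ∀ {q} N → u ^ₛ suc N ≈[ q , N ] 0ₛ
u^suc≈0 zero = ≈-trans (u*≈X* 1ₛ) (≈-trans X-*ₛ-≈0 (≗⇒≈ (*ₛ-zeroʳ X)))
u^suc≈0 (suc N) =
  ≈-trans (u*≈X* (u ^ₛ suc N))
          (≈-trans (X-*ₛ-shift (≈-trans (*ₛ-cong (≈-refl {f = R *ₛ R}) (u^suc≈0 N)) (≗⇒≈ (*ₛ-zeroʳ (R *ₛ R)))))
                   (≗⇒≈ (*ₛ-zeroʳ X)))

bitPoly-stable : ∀ {q N M} → N ≤ M → bitPoly 1 u M ≈[ q , N ] bitPoly 1 u N
bitPoly-stable {N = N} {M} N≤M with ℕ.m≤n⇒m<n∨m≡n N≤M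
... | inj₂ refl = ≈-refl
bitPoly-stable {q} {N} {suc M} _ | inj₁ (s≤s N≤M) = begin
  bitPoly 1 u M +ₛ const (tmBit (suc M)) *ₛ u ^ₛ suc M
    ≈⟨ +ₛ-cong (bitPoly-stable N≤M) (*ₛ-cong (≈-refl {f = const (tmBit (suc M))}) (≈-mono N≤M (u^suc≈0 M))) ⟩
  bitPoly 1 u N +ₛ const (tmBit (suc M)) *ₛ 0ₛ
    ≈⟨ solve 2 (λ B c → B :+ c :* con 0ℤ := B) ≈-refl (bitPoly 1 u N) (const (tmBit (suc M))) ⟩
  bitPoly 1 u N ∎
  where open SeriesMod q N

bitSeries : ℕ → Series
bitSeries n = R *ₛ bitPoly 1 u n

module _ {n : ℕ} where
  open SeriesMod (+ 2) n

  neg≈self : ∀ f → -ₛ f ≈ f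
  neg≈self f k _ = ≡-mod (divides (- f k) (twice (f k)))
    where
    twice : ∀ a → - a - a ≡ - a * + 2
    twice = solve-∀

  square-+ : ∀ a b → (a +ₛ b) *ₛ (a +ₛ b) ≈ a *ₛ a +ₛ b *ₛ b
  square-+ a b = begin
    (a +ₛ b) *ₛ (a +ₛ b)
      ≈⟨ solve 2 (λ a b → (a :+ b) :* (a :+ b) := a :* a :+ b :* b :+ con (+ 2) :* (a :* b)) ≈-refl a b ⟩
    a *ₛ a +ₛ b *ₛ b +ₛ const (+ 2) *ₛ (a *ₛ b)     ≈⟨ +ₛ-cong (≈-refl {f = a *ₛ a +ₛ b *ₛ b}) (const*ₛ≈0 (a *ₛ b)) ⟩
    a *ₛ a +ₛ b *ₛ b +ₛ 0ₛ                           ≈⟨ solve 1 (λ c → c :+ con 0ℤ := c) ≈-refl (a *ₛ a +ₛ b *ₛ b) ⟩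
    a *ₛ a +ₛ b *ₛ b                                 ∎

  bitPoly-frobenius : ∀ y N → bitPoly 1 (y *ₛ y) N ≈ bitPoly 1 y N *ₛ bitPoly 1 y N
  bitPoly-frobenius y zero = solve 0 (con 0ℤ := con 0ℤ :* con 0ℤ) ≈-refl
  bitPoly-frobenius y (suc N) = begin
    bitPoly 1 (y *ₛ y) N +ₛ c *ₛ (y *ₛ y) ^ₛ suc N
      ≈⟨ +ₛ-cong (bitPoly-frobenius y N) (*ₛ-cong c≈c² (≈-sym (^ₛ-square y (suc N)))) ⟩
    A *ₛ A +ₛ (c *ₛ c) *ₛ (p *ₛ p)
      ≈⟨ solve 3 (λ A c p → A :* A :+ (c :* c) :* (p :* p) := A :* A :+ (c :* p) :* (c :* p)) ≈-refl A c p ⟩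
    A *ₛ A +ₛ (c *ₛ p) *ₛ (c *ₛ p)       ≈⟨ square-+ A (c *ₛ p) ⟨
    (A +ₛ c *ₛ p) *ₛ (A +ₛ c *ₛ p)       ∎
    where
    A c p : Series
    A = bitPoly 1 y N
    c = const (tmBit (suc N))
    p = y ^ₛ suc N
    c≈c² : c ≈ c *ₛ c
    c≈c² = ≗⇒≈ (λ k → trans (cong (λ b → const b k) (sym (tmBit-idem (suc N)))) (const-*ₛ-const (tmBit (suc N)) (tmBit (suc N)) k))

  geom-frobenius : ∀ y N → geom (y *ₛ y) N ≈ geom y N *ₛ geom y N
  geom-frobenius y zero = solve 0 (con 1ℤ := con 1ℤ :* con 1ℤ) ≈-refl
  geom-frobenius y (suc N) = begin
    geom (y *ₛ y) N +ₛ (y *ₛ y) ^ₛ suc N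
      ≈⟨ +ₛ-cong (geom-frobenius y N) (≈-sym (^ₛ-square y (suc N))) ⟩
    geom y N *ₛ geom y N +ₛ y ^ₛ suc N *ₛ y ^ₛ suc N     ≈⟨ square-+ (geom y N) (y ^ₛ suc N) ⟨
    (geom y N +ₛ y ^ₛ suc N) *ₛ (geom y N +ₛ y ^ₛ suc N) ∎

  R≈1-u : R ≈ 1ₛ -ₛ u
  R≈1-u = begin
    R                      ≈⟨ solve 2 (λ R u → R := R :+ u :- u) ≈-refl R u ⟩
    R +ₛ u -ₛ u            ≈⟨ +ₛ-cong (≈-trans (solve 2 (λ X R → R :+ X :* R :* R := R :* (con 1ℤ :+ X :* R)) ≈-refl X R)
                                               (≈-∣ (divides (+ 2) refl) (R-fixpoint n)))
                                      (≈-refl {f = -ₛ u}) ⟩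
    1ₛ -ₛ u                ∎

  X*R≈s : X *ₛ R ≈ s
  X*R≈s = begin
    X *ₛ R          ≈⟨ ≗⇒≈ X*R≗X-s² ⟩
    X -ₛ s *ₛ s     ≈⟨ +ₛ-cong (≈-refl {f = X}) (-ₛ-cong (frobenius n s)) ⟩
    X -ₛ s ⟨x²⟩     ≈⟨ +ₛ-cong (≈-refl {f = X}) (neg≈self (s ⟨x²⟩)) ⟩
    X +ₛ s ⟨x²⟩     ≈⟨ ≗⇒≈ s≗X+s⟨x²⟩ ⟨
    s               ∎

  R*geom≈1 : R *ₛ geom u n ≈ 1ₛ
  R*geom≈1 = begin
    R *ₛ geom u n              ≈⟨ *ₛ-cong R≈1-u (≈-refl {f = geom u n}) ⟩
    (1ₛ -ₛ u) *ₛ geom u n      ≈⟨ geom-telescope u n ⟩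
    1ₛ -ₛ u ^ₛ suc n           ≈⟨ +ₛ-cong (≈-refl {f = 1ₛ}) (-ₛ-cong (u^suc≈0 n)) ⟩
    1ₛ -ₛ 0ₛ                   ≈⟨ solve 0 (con 1ℤ :- con 0ℤ := con 1ℤ) ≈-refl ⟩
    1ₛ                         ∎

  bitSeries-quadratic : bitSeries n ≈ bitSeries n *ₛ bitSeries n +ₛ s
  bitSeries-quadratic = begin
    R *ₛ τ                                       ≈⟨ *ₛ-cong (≈-refl {f = R}) (bitPoly-stable (ℕ.m≤n⇒m≤1+n (n≤double n))) ⟨
    R *ₛ bitPoly 1 u (suc (double n))            ≈⟨ *ₛ-cong (≈-refl {f = R}) (bitPoly-split u n) ⟩
    R *ₛ (bitPoly 1 (u *ₛ u) n +ₛ u *ₛ (geom (u *ₛ u) n -ₛ bitPoly 1 (u *ₛ u) n))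
      ≈⟨ *ₛ-cong (≈-refl {f = R}) (+ₛ-cong (bitPoly-frobenius u n)
                                           (*ₛ-cong (≈-refl {f = u}) (+ₛ-cong (geom-frobenius u n) (-ₛ-cong (bitPoly-frobenius u n))))) ⟩
    R *ₛ (τ *ₛ τ +ₛ u *ₛ (S *ₛ S -ₛ τ *ₛ τ))
      ≈⟨ solve 4 (λ X R τ S → R :* (τ :* τ :+ (X :* R :* R) :* (S :* S :- τ :* τ))
                           := R :* (con 1ℤ :- X :* R :* R) :* (τ :* τ) :+ X :* R :* ((R :* S) :* (R :* S))) ≈-refl X R τ S ⟩
    R *ₛ (1ₛ -ₛ u) *ₛ (τ *ₛ τ) +ₛ X *ₛ R *ₛ ((R *ₛ S) *ₛ (R *ₛ S))
      ≈⟨ +ₛ-cong (*ₛ-cong (*ₛ-cong (≈-refl {f = R}) (≈-sym R≈1-u)) (≈-refl {f = τ *ₛ τ}))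
                 (*ₛ-cong (≈-refl {f = X *ₛ R}) (*ₛ-cong R*geom≈1 R*geom≈1)) ⟩
    R *ₛ R *ₛ (τ *ₛ τ) +ₛ X *ₛ R *ₛ (1ₛ *ₛ 1ₛ)
      ≈⟨ solve 3 (λ X R τ → R :* R :* (τ :* τ) :+ X :* R :* (con 1ℤ :* con 1ℤ) := (R :* τ) :* (R :* τ) :+ X :* R) ≈-refl X R τ ⟩
    (R *ₛ τ) *ₛ (R *ₛ τ) +ₛ X *ₛ R                ≈⟨ +ₛ-cong (≈-refl {f = (R *ₛ τ) *ₛ (R *ₛ τ)}) X*R≈s ⟩
    (R *ₛ τ) *ₛ (R *ₛ τ) +ₛ s                     ∎
    where
    τ S : Series
    τ = bitPoly 1 u n
    S = geom u n

  fourPowCount-quadratic : fourPowCount ≈ fourPowCount *ₛ fourPowCount +ₛ s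
  fourPowCount-quadratic = ≈-sym (begin
    P *ₛ P +ₛ s                ≈⟨ +ₛ-cong (frobenius n P) (≗⇒≈ (λ k → sym (fourPowCount+⟨x²⟩≗s k))) ⟩
    P ⟨x²⟩ +ₛ (P +ₛ P ⟨x²⟩)     ≈⟨ solve 2 (λ σ P → σ :+ (P :+ σ) := P :+ con (+ 2) :* σ) ≈-refl (P ⟨x²⟩) P ⟩
    P +ₛ const (+ 2) *ₛ P ⟨x²⟩  ≈⟨ +ₛ-cong (≈-refl {f = P}) (const*ₛ≈0 (P ⟨x²⟩)) ⟩
    P +ₛ 0ₛ                    ≈⟨ solve 1 (λ P → P :+ con 0ℤ := P) ≈-refl P ⟩
    P                          ∎)
    where
    P : Series
    P = fourPowCount

  -- The difference d of two solutions satisfies d ≡ d² + 2P d ≡ d(x²), and d₀ = 0.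
  bitSeries≈fourPowCount : bitSeries n ≈ fourPowCount
  bitSeries≈fourPowCount k k≤n =
    subst₂ (_≡_[mod + 2 ]) (cancel (w k) (P k)) (trans (cong (λ z → z + P k) (const-0 k)) (ℤ.+-identityˡ (P k)))
           (mod-+ (⟨x²⟩-fixed⇒≈0 d≈d⟨x²⟩ d₀≡0 k k≤n) (mod-refl {a = P k}))
    where
    w P d : Series
    w = bitSeries n
    P = fourPowCount
    d = w -ₛ P
    cancel : ∀ a b → a - b + b ≡ a
    cancel = solve-∀
    d≈d⟨x²⟩ : d ≈ d ⟨x²⟩
    d≈d⟨x²⟩ = begin
      w -ₛ P                                   ≈⟨ +ₛ-cong bitSeries-quadratic (-ₛ-cong fourPowCount-quadratic) ⟩
      (w *ₛ w +ₛ s) -ₛ (P *ₛ P +ₛ s)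
        ≈⟨ solve 3 (λ w P s → (w :* w :+ s) :- (P :* P :+ s) := (w :- P) :* (w :- P) :+ con (+ 2) :* (P :* (w :- P))) ≈-refl w P s ⟩
      d *ₛ d +ₛ const (+ 2) *ₛ (P *ₛ d)         ≈⟨ +ₛ-cong (frobenius n d) (const*ₛ≈0 (P *ₛ d)) ⟩
      d ⟨x²⟩ +ₛ 0ₛ                              ≈⟨ solve 1 (λ σ → σ :+ con 0ℤ := σ) ≈-refl (d ⟨x²⟩) ⟩
      d ⟨x²⟩                                    ∎
    d₀≡0 : d 0 ≡ 0ℤ [mod + 2 ]
    d₀≡0 = subst (λ z → z ≡ 0ℤ [mod + 2 ]) (sym (ℤ.+-identityʳ (w 0)))
                 (*ₛ-cong (≈-refl {f = R}) (bitPoly-stable {N = 0} {n} z≤n) 0 z≤n)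


truncation≈rhs : ∀ r → trunc (suc r) ≈[ + 4 , r ] rhs
truncation≈rhs r = begin
  trunc (suc r)                                              ≈⟨ ≗⇒≈ (*ₛ-identityˡ (inv (H r 1))) ⟩
  inv (H r 1)                                                ≈⟨ inv-H-mod4 r 1 ⟩
  R +ₛ const (+ 2) *ₛ bitSeries r                             ≈⟨ +ₛ-cong (≈-refl {f = R}) (2*ₛ-lift bitSeries≈fourPowCount) ⟩
  R +ₛ const (+ 2) *ₛ fourPowCount                           ≈⟨ ≗⇒≈ (λ k → cong (λ z → R k + z) (const-*ₛ (+ 2) fourPowCount k)) ⟩
  rhs                                                        ∎
  where open SeriesMod (+ 4) r

proposition3p3 : (m : ℕ) → ∃ λ N → (n : ℕ) → N ≤ n → trunc n m ≡₄ rhs m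
proposition3p3 m = suc m , eventually
  where
  eventually : (n : ℕ) → suc m ≤ n → trunc n m ≡₄ rhs m
  eventually (suc r) (s≤s m≤r) = ∣⇒∣ᵤ (∣-diff (truncation≈rhs r m m≤r))
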